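{- Let $\mathcal{M}=\mathcal{M}(\Sigma,I)$ be a trace monoid, let $F:\mathcal{M}\to\mathbb{R}$ be any function, and let $H:\mathcal{M}\to\mathbb{R}$ be the graded Möbius transform of $F$. Then for every $u\in\mathcal{M}$, \[ F(u)=\sum_{x\in\mathcal{M}(u)}H(x), \] where $\mathcal{M}(u)=\{x\in\mathcal{M} : \tau(x)=\tau(u)\ \text{and}\ u\leq x\}$ if $u\neq 0$, and $\mathcal{M}(0)=\mathscr{C}$.
   Context: Let $\Sigma$ be a finite alphabet with $|\Sigma|>1$ and $I\subseteq\Sigma\times\Sigma$ a symmetric irreflexive relation. The trace monoid $\mathcal{M}=\mathcal{M}(\Sigma,I)$ is the quotient of the free monoid $\Sigma^*$ by the congruence generated by the pairs $(ab,ba)$ for $(a,b)\in I$; its elements are traces, its product is written $\cdot$ and its identity (the empty trace) is $0$. The prefix order on $\mathcal{M}$ is $u\leq v$ iff $v=u\cdot w$ for some $w\in\mathcal{M}$. A clique is a subset $c\subseteq\Sigma$ such that any two distinct letters of $c$ are related by $I$ (the empty set is the clique $0$); a clique $\{a_1,\dots,a_k\}$ is identified with the trace $a_1\cdot\ldots\cdot a_k$ (independent of the enumeration). $\mathscr{C}$ denotes the set of cliques, $|c|$ the cardinality of $c$, and for cliques $c'\geq c$ means $c\subseteq c'$. For cliques $c,c'$, write $c\to c'$ if for every $b\in c'$ there is $a\in c$ with $(a,b)\notin I$. Every nonempty trace $u$ has a unique decomposition $u=c_1\cdot\ldots\cdot c_n$ with $n\geq1$, nonempty cliques $c_i$, and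 $c_i\to c_{i+1}$ for $1\le i<n$ (the Cartier–Foata decomposition); $c_n$ is its last clique, and $\tau(u)=n$ is the height of $u$, with $\tau(0)=0$. The graded Möbius transform of $F:\mathcal{M}\to\mathbb{R}$ is $H:\mathcal{M}\to\mathbb{R}$ defined as follows: for $u\neq0$, let $c$ be the last clique of the Cartier–Foata decomposition of $u$ and $v$ the unique trace with $u=v\cdot c$; then $H(u)=\sum_{c'\in\mathscr{C},\,c'\geq c}(-1)^{|c'|-|c|}F(v\cdot c')$; and $H(0)=\sum_{c\in\mathscr{C}}(-1)^{|c|}F(c)$. -}

module Defs where

open import Level using (Level; 0ℓ; _⊔_)
open import Data.Bool using (Bool; true; false)
open import Data.Nat using (ℕ; zero; suc; _∸_)
open import Data.Fin using (Fin; _≟_)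
open import Data.Fin.Properties using (all?)
open import Data.Fin.Subset using (Subset; _∈_; _⊆_; ∣_∣; Nonempty)
open import Data.Fin.Subset.Properties using (_∈?_; _⊆?_)
open import Data.Vec using (Vec; []; _∷_)
open import Data.List using (List; []; _∷_; _++_; map; filter; allFin; concatMap; foldr; length; _∷ʳ_)
open import Data.List.Relation.Unary.All using (All)
open import Data.List.Relation.Unary.Any using (Any)
open import Data.List.Relation.Unary.AllPairs using (AllPairs)
open import Data.List.Relation.Unary.Linked using (Linked)
open import Data.Product using (Σ; ∃; _×_)
open import Relation.Binary using (Rel; Decidable)
open import Relation.Binary.PropositionalEquality using (_≡_; _≢_)
open import Relation.Nullary using (¬_; Dec)
open import Relation.Nullary.Decidable using (_→-dec_; ¬?)
open import Algebra.Bundles using (AbelianGroup)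

allSubsets : (m : ℕ) → List (Vec Bool m)
allSubsets zero = [] ∷ []
allSubsets (suc m) = map (true ∷_) (allSubsets m) ++ map (false ∷_) (allSubsets m)

-- Finite sums and signs (-1)^k · a in an abelian group (written multiplicatively in stdlib).
module GroupOps {c ℓ : Level} (G : AbelianGroup c ℓ) where
  open AbelianGroup G
  sumG : List Carrier → Carrier
  sumG = foldr _∙_ ε
  signed : ℕ → Carrier → Carrier
  signed zero a = a
  signed (suc k) a = (signed k a) ⁻¹

-- Trace monoid M(Σ, I) with Σ = Fin n and I a decidable relation.
-- Traces are represented by words (List (Fin n)) modulo the congruence _~_.
module Trace {n : ℕ} (I : Rel (Fin n) 0ℓ) (I? : Decidable I) where

  Word : Set
  Word = List (Fin n)

  data _~_ : Word → Word → Set where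
    ~refl  : ∀ {u} → u ~ u
    ~sym   : ∀ {u v} → u ~ v → v ~ u
    ~trans : ∀ {u v w} → u ~ v → v ~ w → u ~ w
    ~swap  : ∀ (xs ys : Word) (a b : Fin n) → I a b →
             (xs ++ a ∷ b ∷ ys) ~ (xs ++ b ∷ a ∷ ys)

  _≤ₜ_ : Word → Word → Set
  u ≤ₜ v = ∃ λ (w : Word) → v ~ (u ++ w)

  IsClique : Subset n → Set
  IsClique c = ∀ a b → a ∈ c → b ∈ c → a ≢ b → I a b

  isClique? : (c : Subset n) → Dec (IsClique c)
  isClique? c = all? λ a → all? λ b →
    (a ∈? c) →-dec ((b ∈? c) →-dec (¬? (a ≟ b) →-dec I? a b))

  -- the set 𝒞 of cliques (including the empty clique 0)
  cliques : List (Subset n)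
  cliques = filter isClique? (allSubsets n)

  cliqueWord : Subset n → Word
  cliqueWord c = filter (_∈? c) (allFin n)

  _⟶_ : Subset n → Subset n → Set
  c ⟶ c' = ∀ b → b ∈ c' → ∃ λ a → a ∈ c × ¬ I a b

  IsCF : Word → List (Subset n) → Set
  IsCF u cs = (u ~ concatMap cliqueWord cs)
            × All (λ c → IsClique c × Nonempty c) cs
            × Linked _⟶_ cs

  -- τ(u) = k  (τ(0) = 0 is the case of the empty decomposition)
  HasHeight : Word → ℕ → Set
  HasHeight u k = ∃ λ cs → IsCF u cs × length cs ≡ k

  module _ {c ℓ : Level} (G : AbelianGroup c ℓ) where
    open AbelianGroup G
    open GroupOps G

    IsGradedMobius : (Word → Carrier) → (Word → Carrier) → Set ℓ
    IsGradedMobius F H =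
      (∀ (u : Word) (cs : List (Subset n)) (cl : Subset n) →
         IsCF u (cs ∷ʳ cl) →
         H u ≈ sumG (map (λ c' → signed (∣ c' ∣ ∸ ∣ cl ∣)
                                   (F (concatMap cliqueWord cs ++ cliqueWord c')))
                         (filter (λ c' → cl ⊆? c') cliques)))
      × (H [] ≈ sumG (map (λ c' → signed ∣ c' ∣ (F (cliqueWord c'))) cliques))

  InM : Word → Word → Set
  InM [] x = ∃ λ c → IsClique c × (x ~ cliqueWord c)
  InM u@(_ ∷ _) x = (∃ λ k → HasHeight u k × HasHeight x k) × (u ≤ₜ x)

  -- xs is a list of representatives of the finite set {x | P x} of traces,
  -- each class occurring exactly once
  IsEnumeration : (Word → Set) → List Word → Set
  IsEnumeration P xs = All P xs
                     × (∀ x → P x → Any (x ~_) xs)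
                     × AllPairs (λ x y → ¬ (x ~ y)) xs

module Submission where

-- Let u ≠ 0 have Cartier–Foata decomposition v · c, and for x ∈ 𝓜(u) let ℓ(x) be the first
-- layer of v⁻¹x, a clique containing c. For every clique c′ ⊇ c, 𝓜(v · c′) consists of the
-- x ∈ 𝓜(u) with c′ ⊆ ℓ(x). Möbius inversion on the Boolean lattice of cliques above c turns
-- ∑_{c′ ⊇ c} (-1)^{|c′|-|c|} ∑_{𝓜(v · c′)} H into the sum of H over the x with ℓ(x) = c, and u is
-- the only such x. For c′ ≠ c, 𝓜(v · c′) is strictly smaller than 𝓜(u), so by induction
-- F(v · c′) = ∑_{𝓜(v · c′)} H; comparing with the definition of H(u) leaves F(u) = ∑_{𝓜(u)} H.
-- For u = 0 the identity is plain Möbius inversion over the cliques.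

open import Defs
open import Level using (Level; 0ℓ)
open import Algebra.Bundles using (AbelianGroup)
open import Data.Bool using (true; false; if_then_else_)
import Data.Bool as Bool
open import Data.Empty using (⊥-elim)
import Data.Empty
open import Data.Nat using (ℕ; zero; suc; _+_; _∸_; _≤_; _<_; z≤n; s≤s)
import Data.Nat.Properties as ℕ
open import Data.Nat.Induction using (<-wellFounded)
open import Data.Fin using (Fin; _≟_)
open import Data.Fin.Properties using (all?; any?)
open import Data.Fin.Subset using (Subset; ⊥; ∣_∣; Nonempty) renaming (_∈_ to _∈ₛ_; _∉_ to _∉ₛ_; _⊆_ to _⊆ₛ_)
open import Data.Fin.Subset.Properties
  using (_∈?_; _⊆?_; nonempty?; ⊆-refl; ⊆-min; ⊆-antisym; ∉⊥; ∣⊥∣≡0; p⊆q⇒∣p∣≤∣q∣; Empty-unique)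
open import Data.Vec using (tabulate; []; _∷_)
import Data.Vec.Properties as Vec
open import Data.Vec.Properties using (lookup∘tabulate; []=⇒lookup; lookup⇒[]=)
open import Data.Maybe using (just)
import Data.Maybe.Properties as Maybe
open import Data.List
  using (List; []; _∷_; _++_; _∷ʳ_; map; filter; allFin; concatMap; length; head; drop;
         deduplicate; cartesianProductWith; initLast; _∷ʳ′_)
open import Data.List.Properties
  using (filter-++; filter-accept; filter-reject; filter-none; filter-all; filter-≐; map-cong; length-++;
         concatMap-++; ∷-injective; ++-cancelˡ; ++-assoc; ++-identityʳ)
import Data.List.Properties as List
open import Data.List.Extrema ℕ.≤-totalOrder using (max; max≤v⁺; xs≤max)
open import Data.List.Membership.Propositional using (_∈_; _∉_; find)
open import Data.List.Membership.Propositional.Properties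
  using (∈-filter⁻; ∈-filter⁺; ∈-allFin; ∈-map⁺; ∈-map⁻; ∈-++⁺ˡ; ∈-++⁺ʳ;
         ∈-cartesianProductWith⁺; ∈-cartesianProductWith⁻)
open import Data.List.Relation.Unary.All as All using (All; []; _∷_)
import Data.List.Relation.Unary.All.Properties as All
open import Data.List.Relation.Unary.Any as Any using (Any; here; there)
import Data.List.Relation.Unary.Any.Properties as Any
open import Data.List.Relation.Unary.AllPairs using (AllPairs; []; _∷_)
import Data.List.Relation.Unary.AllPairs.Properties as AllPairs
open import Data.List.Relation.Unary.Linked as Linked using (Linked; []; [-]; _∷_)
open import Data.List.Relation.Unary.Unique.Propositional using (Unique)
import Data.List.Relation.Unary.Unique.Propositional.Properties as Unique
import Data.List.Relation.Unary.Unique.Setoid.Properties as UniqueSetoid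
open import Data.List.Relation.Unary.Unique.DecSetoid.Properties using (deduplicate-!)
open import Data.Product using (Σ; ∃; _×_; _,_; proj₁; proj₂)
open import Data.Sum using (_⊎_; inj₁; inj₂; swap)
open import Function using (_∘_)
open import Induction.WellFounded using (WellFounded; Acc; acc)
open import Relation.Binary using (Rel; Decidable; Symmetric; Irreflexive; DecSetoid)
import Relation.Binary.Construct.On as On
open import Relation.Binary.PropositionalEquality using (_≡_; _≢_; refl; sym; trans; cong; cong₂; subst; subst₂)
open import Relation.Nullary using (¬_; Dec; yes; no; does; contradiction)
open import Relation.Nullary.Decidable using (_⊎-dec_; _×-dec_; _→-dec_; ¬?; map′; dec-true)

does-true⇒ : ∀ {P : Set} (d : Dec P) → does d ≡ true → P
does-true⇒ (yes p) _ = p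

allPairs-restrict : ∀ {A : Set} {P : A → Set} {R S : A → A → Set} {xs} → All P xs → AllPairs R xs →
  (∀ {x y} → P x → P y → R x y → S x y) → AllPairs S xs
allPairs-restrict [] [] _ = []
allPairs-restrict (px ∷ pxs) (rx ∷ rxs) restrict =
  All.tabulate (λ y∈ → restrict px (All.lookup pxs y∈) (All.lookup rx y∈)) ∷ allPairs-restrict pxs rxs restrict

∈-allSubsets : ∀ {m} (p : Subset m) → p ∈ allSubsets m
∈-allSubsets []          = here refl
∈-allSubsets (true ∷ p)  = ∈-++⁺ˡ (∈-map⁺ (true ∷_) (∈-allSubsets p))
∈-allSubsets {suc m} (false ∷ p) = ∈-++⁺ʳ (map (true ∷_) (allSubsets m)) (∈-map⁺ (false ∷_) (∈-allSubsets p))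

allSubsets-unique : ∀ m → Unique (allSubsets m)
allSubsets-unique zero    = [] ∷ []
allSubsets-unique (suc m) = Unique.++⁺ (Unique.map⁺ Vec.∷-injectiveʳ (allSubsets-unique m))
                                       (Unique.map⁺ Vec.∷-injectiveʳ (allSubsets-unique m)) disjoint
  where
  disjoint : ∀ {p} → p ∈ map (true ∷_) (allSubsets m) × p ∈ map (false ∷_) (allSubsets m) → Data.Empty.⊥
  disjoint (p∈₁ , p∈₂) with ∈-map⁻ (true ∷_) p∈₁ | ∈-map⁻ (false ∷_) p∈₂
  ... | _ , _ , refl | _ , _ , ()

length-filter-≤ : ∀ {A : Set} {P Q : A → Set} (P? : ∀ x → Dec (P x)) (Q? : ∀ x → Dec (Q x)) xs →
  (∀ {x} → P x → Q x) → length (filter P? xs) ≤ length (filter Q? xs)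
length-filter-≤ P? Q? [] P⇒Q = z≤n
length-filter-≤ P? Q? (x ∷ xs) P⇒Q with P? x | Q? x
... | yes _  | yes _  = s≤s (length-filter-≤ P? Q? xs P⇒Q)
... | yes px | no ¬qx = contradiction (P⇒Q px) ¬qx
... | no _   | yes _  = ℕ.m≤n⇒m≤1+n (length-filter-≤ P? Q? xs P⇒Q)
... | no _   | no _   = length-filter-≤ P? Q? xs P⇒Q

length-filter-< : ∀ {A : Set} {P Q : A → Set} (P? : ∀ x → Dec (P x)) (Q? : ∀ x → Dec (Q x)) xs →
  (∀ {x} → P x → Q x) → Any (λ x → Q x × ¬ P x) xs → length (filter P? xs) < length (filter Q? xs)
length-filter-< P? Q? (x ∷ xs) P⇒Q (here (qx , ¬px)) with P? x | Q? x
... | yes px | _      = contradiction px ¬px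
... | no _   | yes _  = s≤s (length-filter-≤ P? Q? xs P⇒Q)
... | no _   | no ¬qx = contradiction qx ¬qx
length-filter-< P? Q? (x ∷ xs) P⇒Q (there witness) with P? x | Q? x
... | yes _  | yes _  = s≤s (length-filter-< P? Q? xs P⇒Q witness)
... | yes px | no ¬qx = contradiction (P⇒Q px) ¬qx
... | no _   | yes _  = ℕ.m≤n⇒m≤1+n (length-filter-< P? Q? xs P⇒Q witness)
... | no _   | no _   = length-filter-< P? Q? xs P⇒Q witness

∷⇒∷ʳ : ∀ {A : Set} (x : A) xs → ∃ λ ys → ∃ λ y → x ∷ xs ≡ ys ∷ʳ y
∷⇒∷ʳ x [] = [] , x , refl
∷⇒∷ʳ x (z ∷ zs) with ∷⇒∷ʳ z zs
... | ys , y , eq = x ∷ ys , y , cong (x ∷_) eq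

∈⇒≢[] : ∀ {A : Set} {a : A} {xs} → a ∈ xs → xs ≢ []
∈⇒≢[] () refl

only-member : ∀ {A : Set} {t : A} {xs} → Unique xs → t ∈ xs → (∀ {z} → z ∈ xs → z ≡ t) → xs ≡ t ∷ []
only-member {xs = y ∷ []}      _                   _ only = cong (_∷ []) (only (here refl))
only-member {xs = y ∷ y′ ∷ ys} ((y≢y′ ∷ _) ∷ _) _ only =
  contradiction (trans (only (here refl)) (sym (only (there (here refl))))) y≢y′

module FiniteSums {c ℓ : Level} (G : AbelianGroup c ℓ) where
  open AbelianGroup G renaming (refl to ≈-refl; sym to ≈-sym; trans to ≈-trans; reflexive to ≈-reflexive)
  open GroupOps G public
  open import Algebra.Properties.Group group using (∙-cancelˡ; ∙-cancelʳ; ε⁻¹≈ε; ⁻¹-involutive)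
  open import Algebra.Properties.AbelianGroup G using (⁻¹-∙-comm)
  open import Relation.Binary.Reasoning.Setoid setoid

  _≟ₛ_ : ∀ {m} → (a b : Subset m) → Dec (a ≡ b)
  _≟ₛ_ = Vec.≡-dec Bool._≟_

  ∑ : {A : Set} → (A → Carrier) → List A → Carrier
  ∑ f xs = sumG (map f xs)

  -- Defined through does, so that when (map′ f g d) computes like when d: the interval sums
  -- below rely on this to evaluate _⊆?_ and _≟ₛ_ on cons cells.
  when : {P : Set} → Dec P → Carrier → Carrier
  when d a = if does d then a else ε

  when-yes : {P : Set} (d : Dec P) (a : Carrier) → P → when d a ≈ a
  when-yes (yes _) a _ = ≈-refl
  when-yes (no ¬p) a p = contradiction p ¬p

  when-no : {P : Set} (d : Dec P) (a : Carrier) → ¬ P → when d a ≈ ε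
  when-no (yes p) a ¬p = contradiction p ¬p
  when-no (no _) a _ = ≈-refl

  module _ {A : Set} where

    ∑-cong : ∀ {f g : A → Carrier} xs → (∀ {x} → x ∈ xs → f x ≈ g x) → ∑ f xs ≈ ∑ g xs
    ∑-cong [] _ = ≈-refl
    ∑-cong (x ∷ xs) f≈g = ∙-cong (f≈g (here refl)) (∑-cong xs (f≈g ∘ there))

    ∑-ε : ∀ {f : A → Carrier} xs → (∀ {x} → x ∈ xs → f x ≈ ε) → ∑ f xs ≈ ε
    ∑-ε [] _ = ≈-refl
    ∑-ε (x ∷ xs) f≈ε = ≈-trans (∙-cong (f≈ε (here refl)) (∑-ε xs (λ x∈ → f≈ε (there x∈)))) (identityˡ ε)

    ∑-++ : ∀ (f : A → Carrier) xs ys → ∑ f (xs ++ ys) ≈ ∑ f xs ∙ ∑ f ys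
    ∑-++ f [] ys = ≈-sym (identityˡ _)
    ∑-++ f (x ∷ xs) ys = ≈-trans (∙-cong ≈-refl (∑-++ f xs ys)) (≈-sym (assoc _ _ _))

    ∑-map : ∀ {B : Set} (f : B → Carrier) (g : A → B) xs → ∑ f (map g xs) ≡ ∑ (λ x → f (g x)) xs
    ∑-map f g [] = refl
    ∑-map f g (x ∷ xs) = cong (f (g x) ∙_) (∑-map f g xs)

    ∑-∙ : ∀ (f g : A → Carrier) xs → ∑ (λ x → f x ∙ g x) xs ≈ ∑ f xs ∙ ∑ g xs
    ∑-∙ f g [] = ≈-sym (identityˡ ε)
    ∑-∙ f g (x ∷ xs) = begin
      (f x ∙ g x) ∙ ∑ (λ x → f x ∙ g x) xs ≈⟨ ∙-cong ≈-refl (∑-∙ f g xs) ⟩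
      (f x ∙ g x) ∙ (∑ f xs ∙ ∑ g xs)      ≈⟨ assoc _ _ _ ⟩
      f x ∙ (g x ∙ (∑ f xs ∙ ∑ g xs))      ≈⟨ ∙-cong ≈-refl (≈-sym (assoc _ _ _)) ⟩
      f x ∙ ((g x ∙ ∑ f xs) ∙ ∑ g xs)      ≈⟨ ∙-cong ≈-refl (∙-cong (comm _ _) ≈-refl) ⟩
      f x ∙ ((∑ f xs ∙ g x) ∙ ∑ g xs)      ≈⟨ ∙-cong ≈-refl (assoc _ _ _) ⟩
      f x ∙ (∑ f xs ∙ (g x ∙ ∑ g xs))      ≈⟨ ≈-sym (assoc _ _ _) ⟩
      (f x ∙ ∑ f xs) ∙ (g x ∙ ∑ g xs)      ∎

    ∑-filter : ∀ {P : A → Set} (P? : ∀ x → Dec (P x)) (f : A → Carrier) xs →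
               ∑ f (filter P? xs) ≈ ∑ (λ x → when (P? x) (f x)) xs
    ∑-filter P? f [] = ≈-refl
    ∑-filter P? f (x ∷ xs) with P? x
    ... | yes _ = ∙-cong ≈-refl (∑-filter P? f xs)
    ... | no _  = ≈-trans (∑-filter P? f xs) (≈-sym (identityˡ _))

  ∑-comm : ∀ {A B : Set} (h : A → B → Carrier) xs ys →
           ∑ (λ x → ∑ (h x) ys) xs ≈ ∑ (λ y → ∑ (λ x → h x y) xs) ys
  ∑-comm h [] ys = ≈-sym (∑-ε ys (λ _ → ≈-refl))
  ∑-comm h (x ∷ xs) ys = begin
    ∑ (h x) ys ∙ ∑ (λ x → ∑ (h x) ys) xs        ≈⟨ ∙-cong ≈-refl (∑-comm h xs ys) ⟩
    ∑ (h x) ys ∙ ∑ (λ y → ∑ (λ x → h x y) xs) ys ≈⟨ ≈-sym (∑-∙ (h x) (λ y → ∑ (λ x → h x y) xs) ys) ⟩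
    ∑ (λ y → h x y ∙ ∑ (λ x → h x y) xs) ys      ∎

  signed-cong : ∀ k {a b} → a ≈ b → signed k a ≈ signed k b
  signed-cong zero    a≈b = a≈b
  signed-cong (suc k) a≈b = ⁻¹-cong (signed-cong k a≈b)

  signed-ε : ∀ k → signed k ε ≈ ε
  signed-ε zero    = ≈-refl
  signed-ε (suc k) = ≈-trans (⁻¹-cong (signed-ε k)) ε⁻¹≈ε

  signed-∙ : ∀ k a b → signed k (a ∙ b) ≈ signed k a ∙ signed k b
  signed-∙ zero    a b = ≈-refl
  signed-∙ (suc k) a b = ≈-trans (⁻¹-cong (signed-∙ k a b)) (≈-sym (⁻¹-∙-comm _ _))

  signed-∑ : ∀ {A : Set} k (f : A → Carrier) xs → signed k (∑ f xs) ≈ ∑ (λ x → signed k (f x)) xs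
  signed-∑ k f []       = signed-ε k
  signed-∑ k f (x ∷ xs) = ≈-trans (signed-∙ k _ _) (∙-cong ≈-refl (signed-∑ k f xs))

  signed-+-double : ∀ m k a → signed (m + m + k) a ≈ signed k a
  signed-+-double zero    k a = ≈-refl
  signed-+-double (suc m) k a = begin
    signed (suc m + suc m + k) a     ≡⟨ cong (λ t → signed (suc t + k) a) (ℕ.+-suc m m) ⟩
    signed (suc (suc (m + m + k))) a ≈⟨ ⁻¹-involutive _ ⟩
    signed (m + m + k) a             ≈⟨ signed-+-double m k a ⟩
    signed k a                       ∎

  signed-∸ : ∀ {a b} → a ≤ b → ∀ g → signed (b ∸ a) g ≈ signed (a + b) g
  signed-∸ {a} {b} a≤b g = begin
    signed (b ∸ a) g           ≈⟨ ≈-sym (signed-+-double a (b ∸ a) g) ⟩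
    signed (a + a + (b ∸ a)) g ≡⟨ cong (λ t → signed t g) (trans (ℕ.+-assoc a a (b ∸ a)) (cong (a +_) (ℕ.m+[n∸m]≡n a≤b))) ⟩
    signed (a + b) g           ∎

  ∑-when-single : ∀ {A : Set} {P : A → Set} {R : A → A → Set} (P? : ∀ x → Dec (P x)) (f : A → Carrier) {xs} →
    AllPairs R xs → (∀ {x y} → x ∈ xs → y ∈ xs → P x → P y → ¬ R x y) →
    ∀ {x₀} → x₀ ∈ xs → P x₀ → ∑ (λ x → when (P? x) (f x)) xs ≈ f x₀
  ∑-when-single P? f {x ∷ xs} (rx ∷ rxs) unique (here refl) px = begin
    when (P? x) (f x) ∙ ∑ (λ x → when (P? x) (f x)) xs ≈⟨ ∙-cong (when-yes (P? x) (f x) px) (∑-ε xs others) ⟩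
    f x ∙ ε                                            ≈⟨ identityʳ _ ⟩
    f x                                                ∎
    where
    others : ∀ {y} → y ∈ xs → when (P? y) (f y) ≈ ε
    others y∈ = when-no (P? _) _ (λ py → unique (here refl) (there y∈) px py (All.lookup rx y∈))
  ∑-when-single {P = P} P? f {x ∷ xs} (rx ∷ rxs) unique {x₀} (there x₀∈) px₀ = begin
    when (P? x) (f x) ∙ ∑ (λ x → when (P? x) (f x)) xs
      ≈⟨ ∙-cong (when-no (P? x) (f x) ¬px) (∑-when-single P? f rxs (λ x∈ y∈ → unique (there x∈) (there y∈)) x₀∈ px₀) ⟩
    ε ∙ f x₀ ≈⟨ identityˡ _ ⟩
    f x₀     ∎
    where
    ¬px : ¬ P x
    ¬px px = unique (here refl) (there x₀∈) px px₀ (All.lookup rx x₀∈)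

  ∑-cancel-others : ∀ {A : Set} (xs : List A) (f g : A → Carrier) {x₀} → AllPairs _≢_ xs → x₀ ∈ xs →
    (∀ {x} → x ∈ xs → x ≢ x₀ → f x ≈ g x) → ∑ f xs ≈ ∑ g xs → f x₀ ≈ g x₀
  ∑-cancel-others (x ∷ xs) f g (x∉ ∷ _) (here refl) f≈g sums =
    ∙-cancelʳ (∑ f xs) (f x) (g x) (≈-trans sums (∙-cong ≈-refl (≈-sym rest)))
    where
    rest : ∑ f xs ≈ ∑ g xs
    rest = ∑-cong xs (λ y∈ → f≈g (there y∈) (λ y≡x → All.lookup x∉ y∈ (sym y≡x)))
  ∑-cancel-others (x ∷ xs) f g (x∉ ∷ distinct) (there x₀∈) f≈g sums =
    ∑-cancel-others xs f g distinct x₀∈ (λ y∈ → f≈g (there y∈))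
      (∙-cancelˡ (f x) (∑ f xs) (∑ g xs) (≈-trans sums (∙-cong (≈-sym (f≈g (here refl) (All.lookup x∉ x₀∈))) ≈-refl)))

  when-signed-double : ∀ {P : Set} (d : Dec P) m g → when d (signed (m + m) g) ≈ when d g
  when-signed-double (yes _) m g = subst (λ k → signed k g ≈ g) (ℕ.+-identityʳ (m + m)) (signed-+-double m 0 g)
  when-signed-double (no _)  m g = ≈-refl

  ∑-allSubsets-suc : ∀ {m} (f : Subset (suc m) → Carrier) →
    ∑ f (allSubsets (suc m)) ≈ ∑ (λ S → f (true ∷ S)) (allSubsets m) ∙ ∑ (λ S → f (false ∷ S)) (allSubsets m)
  ∑-allSubsets-suc {m} f = ≈-trans (∑-++ f (map (true ∷_) (allSubsets m)) (map (false ∷_) (allSubsets m)))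
    (∙-cong (≈-reflexive (∑-map f (true ∷_) (allSubsets m))) (≈-reflexive (∑-map f (false ∷_) (allSubsets m))))

  when-ε : ∀ {P : Set} (d : Dec P) → when d ε ≈ ε
  when-ε (yes _) = ≈-refl
  when-ε (no _)  = ≈-refl

  intervalTerm : ∀ {m} → Subset m → Subset m → ℕ → Carrier → Subset m → Carrier
  intervalTerm a b j g S = when (a ⊆? S) (when (S ⊆? b) (signed (j + ∣ S ∣) g))

  intervalTerm⁺ : ∀ {m} → Subset m → Subset m → ℕ → Carrier → Subset m → Carrier
  intervalTerm⁺ a b j g S = when (a ⊆? S) (when (S ⊆? b) (signed (j + suc ∣ S ∣) g))

  ∑-interval : ∀ {m} (a b : Subset m) j g →
    ∑ (intervalTerm a b j g) (allSubsets m) ≈ when (a ≟ₛ b) (signed (j + ∣ a ∣) g)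
  ∑-interval⁺ : ∀ {m} (a b : Subset m) j g →
    ∑ (intervalTerm⁺ a b j g) (allSubsets m) ≈ when (a ≟ₛ b) (signed (j + suc ∣ a ∣) g)
  ∑-interval⁺ {m} a b j g = begin
    ∑ (intervalTerm⁺ a b j g) (allSubsets m)
      ≈⟨ ∑-cong (allSubsets m) (λ {S} _ → ≈-reflexive (cong (λ k → when (a ⊆? S) (when (S ⊆? b) (signed k g))) (ℕ.+-suc j ∣ S ∣))) ⟩
    ∑ (intervalTerm a b (suc j) g) (allSubsets m)
      ≈⟨ ∑-interval a b (suc j) g ⟩
    when (a ≟ₛ b) (signed (suc j + ∣ a ∣) g)
      ≡⟨ cong (λ k → when (a ≟ₛ b) (signed k g)) (sym (ℕ.+-suc j ∣ a ∣)) ⟩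
    when (a ≟ₛ b) (signed (j + suc ∣ a ∣) g) ∎

  ∑-interval []          []          j g = identityʳ _
  ∑-interval {suc m} (true ∷ a)  (true ∷ b)  j g = begin
    ∑ (intervalTerm (true ∷ a) (true ∷ b) j g) (allSubsets (suc m))
      ≈⟨ ∑-allSubsets-suc (intervalTerm (true ∷ a) (true ∷ b) j g) ⟩
    ∑ (intervalTerm⁺ a b j g) (allSubsets m) ∙ ∑ (λ _ → ε) (allSubsets m)
      ≈⟨ ∙-cong (∑-interval⁺ a b j g) (∑-ε (allSubsets m) (λ _ → ≈-refl)) ⟩
    when (a ≟ₛ b) (signed (j + suc ∣ a ∣) g) ∙ ε
      ≈⟨ identityʳ _ ⟩
    when (a ≟ₛ b) (signed (j + suc ∣ a ∣) g) ∎
  ∑-interval {suc m} (true ∷ a)  (false ∷ b) j g = begin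
    ∑ (intervalTerm (true ∷ a) (false ∷ b) j g) (allSubsets (suc m))
      ≈⟨ ∑-allSubsets-suc (intervalTerm (true ∷ a) (false ∷ b) j g) ⟩
    ∑ (λ S → when (a ⊆? S) ε) (allSubsets m) ∙ ∑ (λ _ → ε) (allSubsets m)
      ≈⟨ ∙-cong (∑-ε (allSubsets m) (λ {S} _ → when-ε (a ⊆? S))) (∑-ε (allSubsets m) (λ _ → ≈-refl)) ⟩
    ε ∙ ε
      ≈⟨ identityˡ ε ⟩
    ε ∎
  ∑-interval {suc m} (false ∷ a) (true ∷ b)  j g = begin
    ∑ (intervalTerm (false ∷ a) (true ∷ b) j g) (allSubsets (suc m))
      ≈⟨ ∑-allSubsets-suc (intervalTerm (false ∷ a) (true ∷ b) j g) ⟩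
    ∑ (intervalTerm⁺ a b j g) (allSubsets m) ∙ ∑ (intervalTerm a b j g) (allSubsets m)
      ≈⟨ ∙-cong (∑-interval⁺ a b j g) (∑-interval a b j g) ⟩
    when (a ≟ₛ b) (signed (j + suc ∣ a ∣) g) ∙ when (a ≟ₛ b) (signed (j + ∣ a ∣) g)
      ≈⟨ cancel (a ≟ₛ b) ⟩
    ε ∎
    where
    cancel : (d : Dec (a ≡ b)) → when d (signed (j + suc ∣ a ∣) g) ∙ when d (signed (j + ∣ a ∣) g) ≈ ε
    cancel (yes _) = ≈-trans (∙-cong (≈-reflexive (cong (λ k → signed k g) (ℕ.+-suc j ∣ a ∣))) ≈-refl) (inverseˡ _)
    cancel (no _)  = identityˡ ε
  ∑-interval {suc m} (false ∷ a) (false ∷ b) j g = begin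
    ∑ (intervalTerm (false ∷ a) (false ∷ b) j g) (allSubsets (suc m))
      ≈⟨ ∑-allSubsets-suc (intervalTerm (false ∷ a) (false ∷ b) j g) ⟩
    ∑ (λ S → when (a ⊆? S) ε) (allSubsets m) ∙ ∑ (intervalTerm a b j g) (allSubsets m)
      ≈⟨ ∙-cong (∑-ε (allSubsets m) (λ {S} _ → when-ε (a ⊆? S))) (∑-interval a b j g) ⟩
    ε ∙ when (a ≟ₛ b) (signed (j + ∣ a ∣) g)
      ≈⟨ identityˡ _ ⟩
    when (a ≟ₛ b) (signed (j + ∣ a ∣) g) ∎

module TraceTheory {n : ℕ} (I : Rel (Fin n) 0ℓ) (I? : Decidable I)
                   (I-sym : Symmetric I) (I-irrefl : Irreflexive _≡_ I) where
  open Trace I I?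

  Dependent : Fin n → Fin n → Set
  Dependent x y = ¬ I x y

  dependent-refl : ∀ x → Dependent x x
  dependent-refl x = I-irrefl refl

  dependent-sym : ∀ {x y} → Dependent x y → Dependent y x
  dependent-sym d i = d (I-sym i)

  -- Projection lemma: two words are equivalent iff their projections onto all pairs of
  -- dependent letters agree. This makes equivalence decidable, so that 𝓜(u) can be
  -- computed as a finite list of representatives.
  InPair : Fin n → Fin n → Fin n → Set
  InPair x y z = z ≡ x ⊎ z ≡ y

  inPair? : ∀ x y z → Dec (InPair x y z)
  inPair? x y z = (z ≟ x) ⊎-dec (z ≟ y)

  π : Fin n → Fin n → Word → Word
  π x y = filter (inPair? x y)

  π-++ : ∀ x y u v → π x y (u ++ v) ≡ π x y u ++ π x y v
  π-++ x y = filter-++ (inPair? x y)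

  π-keep : ∀ x y {z} w → InPair x y z → π x y (z ∷ w) ≡ z ∷ π x y w
  π-keep x y w = filter-accept (inPair? x y)

  π-drop : ∀ x y {z} w → ¬ InPair x y z → π x y (z ∷ w) ≡ π x y w
  π-drop x y w = filter-reject (inPair? x y)

  π-comm : ∀ x y w → π x y w ≡ π y x w
  π-comm x y = filter-≐ (inPair? x y) (inPair? y x) (swap , swap)

  infix 4 _≃_
  record _≃_ (u v : Word) : Set where
    constructor mk≃
    field π-≡ : ∀ x y → Dependent x y → π x y u ≡ π x y v
  open _≃_ public

  ≃-refl : ∀ {u} → u ≃ u
  ≃-refl = mk≃ λ _ _ _ → refl

  ≡⇒≃ : ∀ {u v} → u ≡ v → u ≃ v
  ≡⇒≃ refl = ≃-refl

  ≃-sym : ∀ {u v} → u ≃ v → v ≃ u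
  ≃-sym p = mk≃ λ x y d → sym (π-≡ p x y d)

  ≃-trans : ∀ {u v w} → u ≃ v → v ≃ w → u ≃ w
  ≃-trans p q = mk≃ λ x y d → trans (π-≡ p x y d) (π-≡ q x y d)

  ++-cong-≃ : ∀ {u u′ v v′} → u ≃ u′ → v ≃ v′ → u ++ v ≃ u′ ++ v′
  ++-cong-≃ {u} {u′} {v} {v′} p q = mk≃ λ x y d →
    trans (π-++ x y u v) (trans (cong₂ _++_ (π-≡ p x y d) (π-≡ q x y d)) (sym (π-++ x y u′ v′)))

  ++-congˡ-≃ : ∀ u {v v′} → v ≃ v′ → u ++ v ≃ u ++ v′
  ++-congˡ-≃ u = ++-cong-≃ (≃-refl {u})

  ++-cancelˡ-≃ : ∀ u {v w} → u ++ v ≃ u ++ w → v ≃ w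
  ++-cancelˡ-≃ u {v} {w} p = mk≃ λ x y d →
    ++-cancelˡ (π x y u) (π x y v) (π x y w) (trans (sym (π-++ x y u v)) (trans (π-≡ p x y d) (π-++ x y u w)))

  π-swap : ∀ x y a b w → Dependent x y → I a b → π x y (a ∷ b ∷ w) ≡ π x y (b ∷ a ∷ w)
  π-swap x y a b w d iab with inPair? x y a | inPair? x y b
  ... | yes pa | yes pb = ⊥-elim (both pa pb)
    where
    both : InPair x y a → InPair x y b → Data.Empty.⊥
    both (inj₁ refl) (inj₁ refl) = I-irrefl refl iab
    both (inj₁ refl) (inj₂ refl) = d iab
    both (inj₂ refl) (inj₁ refl) = d (I-sym iab)
    both (inj₂ refl) (inj₂ refl) = I-irrefl refl iab
  ... | yes pa | no pb = trans (π-keep x y (b ∷ w) pa) (trans (cong (a ∷_) (π-drop x y w pb))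
                           (sym (trans (π-drop x y (a ∷ w) pb) (π-keep x y w pa))))
  ... | no pa | yes pb = trans (π-drop x y (b ∷ w) pa) (trans (π-keep x y w pb)
                           (sym (trans (π-keep x y (a ∷ w) pb) (cong (b ∷_) (π-drop x y w pa)))))
  ... | no pa | no pb = trans (π-drop x y (b ∷ w) pa) (trans (π-drop x y w pb)
                           (sym (trans (π-drop x y (a ∷ w) pb) (π-drop x y w pa))))

  ~⇒≃ : ∀ {u v} → u ~ v → u ≃ v
  ~⇒≃ ~refl = ≃-refl
  ~⇒≃ (~sym p) = ≃-sym (~⇒≃ p)
  ~⇒≃ (~trans p q) = ≃-trans (~⇒≃ p) (~⇒≃ q)
  ~⇒≃ (~swap xs ys a b iab) = mk≃ λ x y d →
    trans (π-++ x y xs (a ∷ b ∷ ys))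
      (trans (cong (π x y xs ++_) (π-swap x y a b ys d iab)) (sym (π-++ x y xs (b ∷ a ∷ ys))))

  ~-congˡ : ∀ p {u v} → u ~ v → (p ++ u) ~ (p ++ v)
  ~-congˡ p ~refl = ~refl
  ~-congˡ p (~sym q) = ~sym (~-congˡ p q)
  ~-congˡ p (~trans q r) = ~trans (~-congˡ p q) (~-congˡ p r)
  ~-congˡ p (~swap xs ys a b iab) =
    subst₂ _~_ (++-assoc p xs (a ∷ b ∷ ys)) (++-assoc p xs (b ∷ a ∷ ys)) (~swap (p ++ xs) ys a b iab)

  ~-moveToFront : ∀ a v₁ v₂ → All (I a) v₁ → (v₁ ++ a ∷ v₂) ~ (a ∷ v₁ ++ v₂)
  ~-moveToFront a [] v₂ [] = ~refl
  ~-moveToFront a (z ∷ v₁) v₂ (iaz ∷ ia) =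
    ~trans (~-congˡ (z ∷ []) (~-moveToFront a v₁ v₂ ia)) (~swap [] (v₁ ++ v₂) z a (I-sym iaz))

  splitAtFirst : ∀ a v → a ∈ v → ∃ λ (v₁ : Word) → ∃ λ (v₂ : Word) → v ≡ v₁ ++ a ∷ v₂ × All (_≢ a) v₁
  splitAtFirst a (z ∷ v) a∈ with z ≟ a
  ... | yes refl = [] , v , refl , []
  ... | no z≢a with a∈
  ...   | here a≡z = ⊥-elim (z≢a (sym a≡z))
  ...   | there a∈v with splitAtFirst a v a∈v
  ...     | v₁ , v₂ , refl , a∉v₁ = z ∷ v₁ , v₂ , refl , z≢a ∷ a∉v₁

  π-startsWith : ∀ a z w₁ w₂ → All (_≢ a) w₁ → z ∈ w₁ → ∃ λ (t : Word) → π a z (w₁ ++ w₂) ≡ z ∷ t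
  π-startsWith a z (w ∷ w₁) w₂ (w≢a ∷ _) (here refl) = _ , π-keep a z (w₁ ++ w₂) (inj₂ refl)
  π-startsWith a z (w ∷ w₁) w₂ (w≢a ∷ a∉w₁) (there z∈w₁) = byHead (w ≟ z)
    where
    byHead : Dec (w ≡ z) → ∃ λ (t : Word) → π a z (w ∷ w₁ ++ w₂) ≡ z ∷ t
    byHead (yes refl) = _ , π-keep a z (w₁ ++ w₂) (inj₂ refl)
    byHead (no w≢z) with π-startsWith a z w₁ w₂ a∉w₁ z∈w₁
    ... | t , eq = t , trans (π-drop a z (w₁ ++ w₂) λ { (inj₁ e) → w≢a e ; (inj₂ e) → w≢z e }) eq

  ≃[]⇒≡[] : ∀ v → [] ≃ v → v ≡ []
  ≃[]⇒≡[] [] p = refl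
  ≃[]⇒≡[] (a ∷ v) p with trans (π-≡ p a a (dependent-refl a)) (π-keep a a v (inj₁ refl))
  ... | ()

  head-∈-≃ : ∀ {a u v} → a ∷ u ≃ v → a ∈ v
  head-∈-≃ {a} {u} {v} p = proj₁ (∈-filter⁻ (inPair? a a) (subst (a ∈_) (sym πv) (here refl)))
    where
    πv : π a a v ≡ a ∷ π a a u
    πv = trans (sym (π-≡ p a a (dependent-refl a))) (π-keep a a u (inj₁ refl))

  independent-beforeFirst : ∀ {a u} v₁ v₂ → a ∷ u ≃ v₁ ++ a ∷ v₂ → All (_≢ a) v₁ → All (I a) v₁
  independent-beforeFirst {a} {u} v₁ v₂ p a∉v₁ = All.tabulate independent
    where
    independent : ∀ {z} → z ∈ v₁ → I a z
    independent {z} z∈v₁ with I? a z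
    ... | yes i = i
    ... | no d = ⊥-elim (All.lookup a∉v₁ z∈v₁ (sym (proj₁ (∷-injective
      (trans (sym (π-keep a z u (inj₁ refl))) (trans (π-≡ p a z d) (proj₂ (π-startsWith a z v₁ (a ∷ v₂) a∉v₁ z∈v₁))))))))

  ∷-cancel-≃ : ∀ {a u v} → a ∷ u ≃ a ∷ v → u ≃ v
  ∷-cancel-≃ = ++-cancelˡ-≃ (_ ∷ [])

  ≃⇒~ : ∀ {u v} → u ≃ v → u ~ v
  ≃⇒~ {[]} {v} p rewrite ≃[]⇒≡[] v p = ~refl
  ≃⇒~ {a ∷ u} {v} p with splitAtFirst a v (head-∈-≃ p)
  ... | v₁ , v₂ , refl , a∉v₁ = ~trans (~-congˡ (a ∷ []) (≃⇒~ tail≃)) (~sym toFront)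
    where
    toFront : (v₁ ++ a ∷ v₂) ~ (a ∷ v₁ ++ v₂)
    toFront = ~-moveToFront a v₁ v₂ (independent-beforeFirst v₁ v₂ p a∉v₁)
    tail≃ : u ≃ v₁ ++ v₂
    tail≃ = ∷-cancel-≃ (≃-trans p (~⇒≃ toFront))

  _≃?_ : ∀ u v → Dec (u ≃ v)
  u ≃? v = map′ mk≃ π-≡ (all? λ x → all? λ y → ¬? (I? x y) →-dec List.≡-dec _≟_ (π x y u) (π x y v))

  -- Cancelling prefixes and the prefix order

  delete : Fin n → Word → Word
  delete a [] = []
  delete a (z ∷ w) with a ≟ z
  ... | yes _ = w
  ... | no _  = z ∷ delete a w

  delete-head : ∀ a w → delete a (a ∷ w) ≡ w
  delete-head a w with a ≟ a
  ... | yes _ = refl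
  ... | no a≢a = contradiction refl a≢a

  delete-skip : ∀ {a z} w → a ≢ z → delete a (z ∷ w) ≡ z ∷ delete a w
  delete-skip {a} {z} w a≢z with a ≟ z
  ... | yes a≡z = contradiction a≡z a≢z
  ... | no _ = refl

  π-delete-kept : ∀ x y {a} w → InPair x y a → π x y (delete a w) ≡ delete a (π x y w)
  π-delete-kept x y [] _ = refl
  π-delete-kept x y {a} (z ∷ w) a∈xy = byCases (a ≟ z) (inPair? x y z)
    where
    byCases : Dec (a ≡ z) → Dec (InPair x y z) → π x y (delete a (z ∷ w)) ≡ delete a (π x y (z ∷ w))
    byCases (yes refl) _ = trans (cong (π x y) (delete-head a w))
      (sym (trans (cong (delete a) (π-keep x y w a∈xy)) (delete-head a (π x y w))))
    byCases (no a≢z) (yes z∈xy) = trans (cong (π x y) (delete-skip w a≢z))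
      (trans (π-keep x y (delete a w) z∈xy) (trans (cong (z ∷_) (π-delete-kept x y w a∈xy))
        (sym (trans (cong (delete a) (π-keep x y w z∈xy)) (delete-skip (π x y w) a≢z)))))
    byCases (no a≢z) (no z∉xy) = trans (cong (π x y) (delete-skip w a≢z))
      (trans (π-drop x y (delete a w) z∉xy) (trans (π-delete-kept x y w a∈xy)
        (sym (cong (delete a) (π-drop x y w z∉xy)))))

  π-delete-dropped : ∀ x y {a} w → ¬ InPair x y a → π x y (delete a w) ≡ π x y w
  π-delete-dropped x y [] _ = refl
  π-delete-dropped x y {a} (z ∷ w) a∉xy = byCases (a ≟ z) (inPair? x y z)
    where
    byCases : Dec (a ≡ z) → Dec (InPair x y z) → π x y (delete a (z ∷ w)) ≡ π x y (z ∷ w)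
    byCases (yes refl) _ = trans (cong (π x y) (delete-head a w)) (sym (π-drop x y w a∉xy))
    byCases (no a≢z) (yes z∈xy) = trans (cong (π x y) (delete-skip w a≢z))
      (trans (π-keep x y (delete a w) z∈xy) (trans (cong (z ∷_) (π-delete-dropped x y w a∉xy)) (sym (π-keep x y w z∈xy))))
    byCases (no a≢z) (no z∉xy) = trans (cong (π x y) (delete-skip w a≢z))
      (trans (π-drop x y (delete a w) z∉xy) (trans (π-delete-dropped x y w a∉xy) (sym (π-drop x y w z∉xy))))

  infixl 6 _÷_
  _÷_ : Word → Word → Word
  w ÷ [] = w
  w ÷ (a ∷ u) = delete a w ÷ u

  π-÷ : ∀ x y w u → π x y (w ÷ u) ≡ π x y w ÷ π x y u
  π-÷ x y w [] = refl
  π-÷ x y w (a ∷ u) = byCases (inPair? x y a)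
    where
    byCases : Dec (InPair x y a) → π x y (delete a w ÷ u) ≡ π x y w ÷ π x y (a ∷ u)
    byCases (yes a∈xy) = trans (π-÷ x y (delete a w) u)
      (trans (cong (_÷ π x y u) (π-delete-kept x y w a∈xy)) (sym (cong (π x y w ÷_) (π-keep x y u a∈xy))))
    byCases (no a∉xy) = trans (π-÷ x y (delete a w) u)
      (trans (cong (_÷ π x y u) (π-delete-dropped x y w a∉xy)) (sym (cong (π x y w ÷_) (π-drop x y u a∉xy))))

  ÷-cong-≃ : ∀ {w w′} u → w ≃ w′ → w ÷ u ≃ w′ ÷ u
  ÷-cong-≃ {w} {w′} u p = mk≃ λ x y d →
    trans (π-÷ x y w u) (trans (cong (_÷ π x y u) (π-≡ p x y d)) (sym (π-÷ x y w′ u)))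

  ++-÷ : ∀ u w → (u ++ w) ÷ u ≡ w
  ++-÷ [] w = refl
  ++-÷ (a ∷ u) w = trans (cong (_÷ u) (delete-head a (u ++ w))) (++-÷ u w)

  _≤ₜ?_ : ∀ u x → Dec (u ≤ₜ x)
  u ≤ₜ? x with x ≃? (u ++ x ÷ u)
  ... | yes p = yes (x ÷ u , ≃⇒~ p)
  ... | no ¬p = no λ (w , x~uw) → ¬p (quotient-witness w (~⇒≃ x~uw))
    where
    quotient-witness : ∀ w → x ≃ u ++ w → x ≃ u ++ x ÷ u
    quotient-witness w p = ≃-trans p (++-congˡ-≃ u (subst (_≃ x ÷ u) (++-÷ u w) (÷-cong-≃ u (≃-sym p))))

  ≤ₜ-respˡ-≃ : ∀ {u u′ x} → u ≃ u′ → u ≤ₜ x → u′ ≤ₜ x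
  ≤ₜ-respˡ-≃ p (w , q) = w , ≃⇒~ (≃-trans (~⇒≃ q) (++-cong-≃ p (≃-refl {w})))

  ≤ₜ-respʳ-≃ : ∀ {u x x′} → x ≃ x′ → u ≤ₜ x → u ≤ₜ x′
  ≤ₜ-respʳ-≃ p (w , q) = w , ≃⇒~ (≃-trans (≃-sym p) (~⇒≃ q))

  ≤ₜ-reflexive : ∀ {u x} → u ≃ x → u ≤ₜ x
  ≤ₜ-reflexive {u} p = [] , ≃⇒~ (≃-trans (≃-sym p) (≡⇒≃ (sym (++-identityʳ u))))

  ≤ₜ-trans : ∀ {u y x} → u ≤ₜ y → y ≤ₜ x → u ≤ₜ x
  ≤ₜ-trans {u} (w₁ , q₁) (w₂ , q₂) = w₁ ++ w₂ , ≃⇒~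
    (≃-trans (~⇒≃ q₂) (≃-trans (++-cong-≃ (~⇒≃ q₁) (≃-refl {w₂})) (≡⇒≃ (++-assoc u w₁ w₂))))

  ∈-cliqueWord⁺ : ∀ {a c} → a ∈ₛ c → a ∈ cliqueWord c
  ∈-cliqueWord⁺ {a} {c} a∈c = ∈-filter⁺ (_∈? c) (∈-allFin a) a∈c

  ∈-cliqueWord⁻ : ∀ {a c} → a ∈ cliqueWord c → a ∈ₛ c
  ∈-cliqueWord⁻ {a} {c} a∈ = proj₂ (∈-filter⁻ (_∈? c) {xs = allFin n} a∈)

  cliqueWord-unique : ∀ c → Unique (cliqueWord c)
  cliqueWord-unique c = Unique.filter⁺ (_∈? c) (Unique.allFin⁺ n)

  cliqueWord-⊥ : cliqueWord ⊥ ≡ []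
  cliqueWord-⊥ = filter-none (_∈? ⊥) {allFin n} (All.tabulate λ _ → ∉⊥)

  ∈-π-cliqueWord⁻ : ∀ {x y z} c → z ∈ π x y (cliqueWord c) → z ∈ₛ c × InPair x y z
  ∈-π-cliqueWord⁻ {x} {y} c z∈ with ∈-filter⁻ (inPair? x y) {xs = cliqueWord c} z∈
  ... | z∈c , z∈xy = ∈-cliqueWord⁻ z∈c , z∈xy

  π-cliqueWord-singleton : ∀ {x y t} c → t ∈ₛ c → InPair x y t →
    (∀ {z} → z ∈ₛ c → InPair x y z → z ≡ t) → π x y (cliqueWord c) ≡ t ∷ []
  π-cliqueWord-singleton {x} {y} c t∈c t∈xy only =
    only-member (Unique.filter⁺ (inPair? x y) (cliqueWord-unique c))
      (∈-filter⁺ (inPair? x y) (∈-cliqueWord⁺ t∈c) t∈xy)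
      (λ z∈ → let z∈c , z∈xy = ∈-π-cliqueWord⁻ c z∈ in only z∈c z∈xy)

  π-cliqueWord-first : ∀ {x y c} → IsClique c → Dependent x y → x ∈ₛ c → π x y (cliqueWord c) ≡ x ∷ []
  π-cliqueWord-first {x} {y} {c} clique dep x∈c = π-cliqueWord-singleton c x∈c (inj₁ refl) only
    where
    only : ∀ {z} → z ∈ₛ c → InPair x y z → z ≡ x
    only _ (inj₁ z≡x) = z≡x
    only y∈c (inj₂ refl) with x ≟ y
    ... | yes x≡y = sym x≡y
    ... | no x≢y = contradiction (clique x y x∈c y∈c x≢y) dep

  π-cliqueWord-second : ∀ {x y c} → x ∉ₛ c → y ∈ₛ c → π x y (cliqueWord c) ≡ y ∷ []
  π-cliqueWord-second {x} {y} {c} x∉c y∈c = π-cliqueWord-singleton c y∈c (inj₂ refl) only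
    where
    only : ∀ {z} → z ∈ₛ c → InPair x y z → z ≡ y
    only x∈c (inj₁ refl) = contradiction x∈c x∉c
    only _ (inj₂ z≡y) = z≡y

  π-cliqueWord-none : ∀ {x y c} → x ∉ₛ c → y ∉ₛ c → π x y (cliqueWord c) ≡ []
  π-cliqueWord-none {x} {y} {c} x∉c y∉c = filter-none (inPair? x y) (All.tabulate none)
    where
    none : ∀ {z} → z ∈ cliqueWord c → ¬ InPair x y z
    none z∈ (inj₁ refl) = x∉c (∈-cliqueWord⁻ z∈)
    none z∈ (inj₂ refl) = y∉c (∈-cliqueWord⁻ z∈)

  cliques-isClique : All IsClique cliques
  cliques-isClique = All.tabulate λ c∈ → proj₂ (∈-filter⁻ isClique? {xs = allSubsets n} c∈)

  ∈-cliques : ∀ {c} → IsClique c → c ∈ cliques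
  ∈-cliques {c} clique = ∈-filter⁺ isClique? (∈-allSubsets c) clique

  cliques-unique : Unique cliques
  cliques-unique = Unique.filter⁺ isClique? (allSubsets-unique n)

  ⊆-isClique : ∀ {S M} → IsClique M → S ⊆ₛ M → IsClique S
  ⊆-isClique clique S⊆M a b a∈ b∈ a≢b = clique a b (S⊆M a∈) (S⊆M b∈) a≢b

  -- Minimal letters and the Cartier–Foata decomposition

  -- a is minimal in w when it occurs in w and no letter dependent on a precedes its first
  -- occurrence, i.e. when a can be moved to the front of w.
  record Minimal (a : Fin n) (w : Word) : Set where
    constructor mkMinimal
    field head-π : ∀ y → Dependent a y → head (π a y w) ≡ just a
  open Minimal public

  minimal? : ∀ a w → Dec (Minimal a w)
  minimal? a w = map′ mkMinimal head-π
    (all? λ y → ¬? (I? a y) →-dec Maybe.≡-dec _≟_ (head (π a y w)) (just a))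

  minimalLetters : Word → Subset n
  minimalLetters w = tabulate (λ a → does (minimal? a w))

  ∈-minimalLetters⁺ : ∀ {a w} → Minimal a w → a ∈ₛ minimalLetters w
  ∈-minimalLetters⁺ {a} {w} m = lookup⇒[]= a _ (trans (lookup∘tabulate _ a) (dec-true (minimal? a w) m))

  ∈-minimalLetters⁻ : ∀ {a} w → a ∈ₛ minimalLetters w → Minimal a w
  ∈-minimalLetters⁻ {a} w a∈ = does-true⇒ (minimal? a w) (trans (sym (lookup∘tabulate _ a)) ([]=⇒lookup a∈))

  Minimal-resp-≃ : ∀ {a w w′} → w ≃ w′ → Minimal a w → Minimal a w′
  Minimal-resp-≃ {a} p m = mkMinimal λ y d → trans (cong head (sym (π-≡ p a y d))) (head-π m y d)

  minimalLetters-resp-≃ : ∀ {w w′} → w ≃ w′ → minimalLetters w ≡ minimalLetters w′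
  minimalLetters-resp-≃ {w} {w′} p = ⊆-antisym
    (λ a∈ → ∈-minimalLetters⁺ (Minimal-resp-≃ p (∈-minimalLetters⁻ w a∈)))
    (λ a∈ → ∈-minimalLetters⁺ (Minimal-resp-≃ (≃-sym p) (∈-minimalLetters⁻ w′ a∈)))

  minimalLetters-isClique : ∀ w → IsClique (minimalLetters w)
  minimalLetters-isClique w a b a∈ b∈ a≢b with I? a b
  ... | yes i = i
  ... | no d = contradiction (Maybe.just-injective (trans (sym (head-π (∈-minimalLetters⁻ w a∈) b d))
                 (trans (cong head (π-comm a b w)) (head-π (∈-minimalLetters⁻ w b∈) a (dependent-sym d))))) a≢b

  Minimal-head : ∀ a w → Minimal a (a ∷ w)
  Minimal-head a w = mkMinimal λ y _ → cong head (π-keep a y w (inj₁ refl))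

  Minimal-cliqueWord : ∀ {a c} w → IsClique c → a ∈ₛ c → Minimal a (cliqueWord c ++ w)
  Minimal-cliqueWord {a} {c} w clique a∈c = mkMinimal λ y d →
    cong head (trans (π-++ a y (cliqueWord c) w) (cong (_++ π a y w) (π-cliqueWord-first clique d a∈c)))

  Minimal-skip : ∀ {b c w} → (∀ a → a ∈ₛ c → I a b) → Minimal b w → Minimal b (cliqueWord c ++ w)
  Minimal-skip {b} {c} {w} indep m = mkMinimal λ y d →
    trans (cong head (trans (π-++ b y (cliqueWord c) w) (cong (_++ π b y w)
      (π-cliqueWord-none (λ b∈c → I-irrefl refl (indep b b∈c)) (λ y∈c → d (I-sym (indep y y∈c)))))))
      (head-π m y d)

  Minimal⇒∈ : ∀ {a w} → Minimal a w → a ∈ w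
  Minimal⇒∈ {a} {w} m with π a a w in eq | head-π m a (dependent-refl a)
  ... | b ∷ _ | refl = proj₁ (∈-filter⁻ (inPair? a a) {xs = w} (subst (b ∈_) (sym eq) (here refl)))

  minimalLetters-cliqueWord : ∀ {c} → IsClique c → minimalLetters (cliqueWord c) ≡ c
  minimalLetters-cliqueWord {c} clique = ⊆-antisym
    (λ a∈ → ∈-cliqueWord⁻ (Minimal⇒∈ (∈-minimalLetters⁻ (cliqueWord c) a∈)))
    (λ a∈c → ∈-minimalLetters⁺ (subst (Minimal _) (++-identityʳ (cliqueWord c)) (Minimal-cliqueWord [] clique a∈c)))

  pullClique : ∀ {c} z → IsClique c → (∀ {a} → a ∈ₛ c → Minimal a z) → z ≃ cliqueWord c ++ z ÷ cliqueWord c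
  pullClique {c} z clique minimal = mk≃ λ x y d → sym (trans (π-++ x y (cliqueWord c) (z ÷ cliqueWord c))
      (trans (cong (π x y (cliqueWord c) ++_) (π-÷ x y z (cliqueWord c))) (byMembership x y d (x ∈? c) (y ∈? c))))
    where
    ∷-head : ∀ {a} (w : Word) → head w ≡ just a → w ≡ a ∷ drop 1 w
    ∷-head (b ∷ w) refl = refl
    byMembership : ∀ x y → Dependent x y → Dec (x ∈ₛ c) → Dec (y ∈ₛ c) →
                   π x y (cliqueWord c) ++ π x y z ÷ π x y (cliqueWord c) ≡ π x y z
    byMembership x y d (yes x∈c) _
      rewrite π-cliqueWord-first clique d x∈c | ∷-head (π x y z) (head-π (minimal x∈c) y d)
      = cong (x ∷_) (delete-head x _)
    byMembership x y d (no x∉c) (yes y∈c)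
      rewrite π-cliqueWord-second x∉c y∈c | π-comm x y z | ∷-head (π y x z) (head-π (minimal y∈c) x (dependent-sym d))
      = cong (y ∷_) (delete-head y _)
    byMembership x y d (no x∉c) (no y∉c) rewrite π-cliqueWord-none x∉c y∉c = refl

  length-delete≤ : ∀ b x → length (delete b x) ≤ length x
  length-delete≤ b [] = z≤n
  length-delete≤ b (z ∷ x) with b ≟ z
  ... | yes _ = ℕ.n≤1+n _
  ... | no _  = s≤s (length-delete≤ b x)

  length-delete< : ∀ {b} x → b ∈ x → length (delete b x) < length x
  length-delete< {b} (z ∷ x) b∈ with b ≟ z
  ... | yes _ = ℕ.≤-refl
  ... | no b≢z with b∈
  ...   | here b≡z = contradiction b≡z b≢z
  ...   | there b∈x = s≤s (length-delete< x b∈x)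

  length-÷≤ : ∀ x u → length (x ÷ u) ≤ length x
  length-÷≤ x [] = ℕ.≤-refl
  length-÷≤ x (a ∷ u) = ℕ.≤-trans (length-÷≤ (delete a x) u) (length-delete≤ a x)

  peelOff : Word → Word
  peelOff w = w ÷ cliqueWord (minimalLetters w)

  peelOff-shrinks : ∀ a w → length (peelOff (a ∷ w)) ≤ length w
  peelOff-shrinks a w with cliqueWord (minimalLetters (a ∷ w)) in eq
  ... | [] = contradiction (subst (a ∈_) eq (∈-cliqueWord⁺ (∈-minimalLetters⁺ (Minimal-head a w)))) λ ()
  ... | b ∷ u = ℕ.≤-pred (ℕ.≤-<-trans (length-÷≤ (delete b (a ∷ w)) u) (length-delete< (a ∷ w) b∈))
    where
    b∈ : b ∈ a ∷ w
    b∈ = Minimal⇒∈ (∈-minimalLetters⁻ (a ∷ w) (∈-cliqueWord⁻ (subst (b ∈_) (sym eq) (here refl))))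

  pullMinimalLetters : ∀ w → w ≃ cliqueWord (minimalLetters w) ++ peelOff w
  pullMinimalLetters w = pullClique w (minimalLetters-isClique w) (∈-minimalLetters⁻ w)

  peel : ℕ → Word → List (Subset n)
  peel zero    _ = []
  peel (suc k) [] = []
  peel (suc k) w@(_ ∷ _) = minimalLetters w ∷ peel k (peelOff w)

  cartierFoata : Word → List (Subset n)
  cartierFoata w = peel (length w) w

  layersWord : List (Subset n) → Word
  layersWord = concatMap cliqueWord

  NonemptyClique : Subset n → Set
  NonemptyClique c = IsClique c × Nonempty c

  IsLayering : List (Subset n) → Set
  IsLayering cs = All NonemptyClique cs × Linked _⟶_ cs

  peel-≃ : ∀ k w → length w ≤ k → w ≃ layersWord (peel k w)
  peel-≃ zero    []        _ = ≃-refl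
  peel-≃ (suc k) []        _ = ≃-refl
  peel-≃ (suc k) w@(a ∷ v) (s≤s |v|≤k) = ≃-trans (pullMinimalLetters w)
    (++-congˡ-≃ (cliqueWord (minimalLetters w)) (peel-≃ k (peelOff w) (ℕ.≤-trans (peelOff-shrinks a v) |v|≤k)))

  peel-nonemptyCliques : ∀ k w → All NonemptyClique (peel k w)
  peel-nonemptyCliques zero    _ = []
  peel-nonemptyCliques (suc k) [] = []
  peel-nonemptyCliques (suc k) w@(a ∷ v) =
    (minimalLetters-isClique w , a , ∈-minimalLetters⁺ (Minimal-head a v)) ∷ peel-nonemptyCliques k (peelOff w)

  -- A letter of the second layer independent of the whole first layer would itself be minimal.
  minimalLetters-⟶ : ∀ w → minimalLetters w ⟶ minimalLetters (peelOff w)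
  minimalLetters-⟶ w b b∈ with any? (λ a → (a ∈? minimalLetters w) ×-dec ¬? (I? a b))
  ... | yes dependentWitness = dependentWitness
  ... | no none = contradiction (independent b b∈first) (I-irrefl refl)
    where
    independent : ∀ a → a ∈ₛ minimalLetters w → I a b
    independent a a∈ with I? a b
    ... | yes i = i
    ... | no d = contradiction (a , a∈ , d) none
    b∈first : b ∈ₛ minimalLetters w
    b∈first = ∈-minimalLetters⁺ (Minimal-resp-≃ (≃-sym (pullMinimalLetters w))
      (Minimal-skip independent (∈-minimalLetters⁻ (peelOff w) b∈)))

  peel-linked : ∀ k w → length w ≤ k → Linked _⟶_ (peel k w)
  peel-linked zero    _ _ = []
  peel-linked (suc k) [] _ = []
  peel-linked (suc k) w@(a ∷ v) (s≤s |v|≤k) =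
    link k (peelOff w) (ℕ.≤-trans (peelOff-shrinks a v) |v|≤k) (minimalLetters-⟶ w)
    where
    link : ∀ k w′ → length w′ ≤ k → minimalLetters w ⟶ minimalLetters w′ → Linked _⟶_ (minimalLetters w ∷ peel k w′)
    link zero    _ _ _ = [-]
    link (suc k) [] _ _ = [-]
    link (suc k) w′@(_ ∷ _) |w′|≤k arrow = arrow ∷ peel-linked (suc k) w′ |w′|≤k

  cartierFoata-isCF : ∀ w → IsCF w (cartierFoata w)
  cartierFoata-isCF w = ≃⇒~ (peel-≃ (length w) w ℕ.≤-refl) , peel-nonemptyCliques (length w) w , peel-linked (length w) w ℕ.≤-refl

  isCF⇒isLayering : ∀ {u cs} → IsCF u cs → IsLayering cs
  isCF⇒isLayering (_ , nonempty , linked) = nonempty , linked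

  -- Height

  maxOf : (Fin n → ℕ) → ℕ
  maxOf f = max 0 (map f (allFin n))

  ≤-maxOf : ∀ f i → f i ≤ maxOf f
  ≤-maxOf f i = All.lookup (xs≤max 0 (map f (allFin n))) (∈-map⁺ f (∈-allFin i))

  maxOf-≤ : ∀ {f k} → (∀ i → f i ≤ k) → maxOf f ≤ k
  maxOf-≤ f≤k = max≤v⁺ {xs = map _ (allFin n)} z≤n (All.map⁺ (All.tabulate λ {i} _ → f≤k i))

  maxOf-cong : ∀ {f g} → (∀ i → f i ≡ g i) → maxOf f ≡ maxOf g
  maxOf-cong f≗g = cong (max 0) (map-cong f≗g (allFin n))

  -- The height is computed by an automaton that assigns to each letter the index of the
  -- last layer containing it: a new occurrence of a lands one layer above every letter
  -- dependent on a.
  Levels : Set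
  Levels = Fin n → ℕ

  levels₀ : Levels
  levels₀ _ = 0

  dependentLevel : Fin n → Levels → Fin n → ℕ
  dependentLevel a s b = if does (I? a b) then 0 else s b

  maxDependent : Fin n → Levels → ℕ
  maxDependent a s = maxOf (dependentLevel a s)

  step : Fin n → Levels → Levels
  step a s b = if does (b ≟ a) then suc (maxDependent a s) else s b

  run : Levels → Word → Levels
  run s [] = s
  run s (a ∷ w) = run (step a s) w

  height : Word → ℕ
  height w = maxOf (run levels₀ w)

  step-self : ∀ a s → step a s a ≡ suc (maxDependent a s)
  step-self a s with a ≟ a
  ... | yes _  = refl
  ... | no a≢a = contradiction refl a≢a

  maxDependent-≤ : ∀ a {s k} → (∀ b → s b ≤ k) → maxDependent a s ≤ k
  maxDependent-≤ a {s} s≤k = maxOf-≤ bound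
    where
    bound : ∀ b → dependentLevel a s b ≤ _
    bound b with I? a b
    ... | yes _ = z≤n
    ... | no _  = s≤k b

  ≤-maxDependent : ∀ a s {b} → ¬ I a b → s b ≤ maxDependent a s
  ≤-maxDependent a s {b} ¬iab = ℕ.≤-trans (≤-dependentLevel) (≤-maxOf (dependentLevel a s) b)
    where
    ≤-dependentLevel : s b ≤ dependentLevel a s b
    ≤-dependentLevel with I? a b
    ... | yes iab = contradiction iab ¬iab
    ... | no _    = ℕ.≤-refl

  step-cong : ∀ a {s s′} → (∀ b → s b ≡ s′ b) → ∀ b → step a s b ≡ step a s′ b
  step-cong a {s} {s′} s≗s′ b with b ≟ a
  ... | yes _ = cong suc (maxOf-cong dependentLevel-cong)
    where
    dependentLevel-cong : ∀ c → dependentLevel a s c ≡ dependentLevel a s′ c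
    dependentLevel-cong c with I? a c
    ... | yes _ = refl
    ... | no _  = s≗s′ c
  ... | no _ = s≗s′ b

  run-cong : ∀ w {s s′} → (∀ b → s b ≡ s′ b) → ∀ b → run s w b ≡ run s′ w b
  run-cong [] s≗s′ = s≗s′
  run-cong (a ∷ w) s≗s′ = run-cong w (step-cong a s≗s′)

  run-++ : ∀ s u w → run s (u ++ w) ≡ run (run s u) w
  run-++ s [] w = refl
  run-++ s (a ∷ u) w = run-++ (step a s) u w

  maxDependent-step-independent : ∀ {a b} s → I b a → maxDependent b (step a s) ≡ maxDependent b s
  maxDependent-step-independent {a} {b} s iba = maxOf-cong unchanged
    where
    unchanged : ∀ c → dependentLevel b (step a s) c ≡ dependentLevel b s c
    unchanged c with I? b c
    ... | yes _ = refl
    ... | no ¬ibc with c ≟ a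
    ...   | yes refl = contradiction iba ¬ibc
    ...   | no _     = refl

  step-comm : ∀ {a b} s → I a b → ∀ c → step b (step a s) c ≡ step a (step b s) c
  step-comm {a} {b} s iab c with c ≟ b | c ≟ a
  ... | yes refl | yes refl = contradiction iab (I-irrefl refl)
  ... | yes refl | no _     = cong suc (maxDependent-step-independent s (I-sym iab))
  ... | no _     | yes refl = sym (cong suc (maxDependent-step-independent s iab))
  ... | no _     | no _     = refl

  run-resp-~ : ∀ {u v} → u ~ v → ∀ s b → run s u b ≡ run s v b
  run-resp-~ ~refl s b = refl
  run-resp-~ (~sym p) s b = sym (run-resp-~ p s b)
  run-resp-~ (~trans p q) s b = trans (run-resp-~ p s b) (run-resp-~ q s b)
  run-resp-~ (~swap xs ys a b iab) s c =
    trans (cong (λ t → t c) (run-++ s xs (a ∷ b ∷ ys)))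
      (trans (run-cong ys (step-comm (run s xs) iab) c) (sym (cong (λ t → t c) (run-++ s xs (b ∷ a ∷ ys)))))

  height-resp-~ : ∀ {u v} → u ~ v → height u ≡ height v
  height-resp-~ p = maxOf-cong (run-resp-~ p levels₀)

  step-increasing : ∀ a s b → s b ≤ step a s b
  step-increasing a s b with b ≟ a
  ... | yes refl = ℕ.m≤n⇒m≤1+n (≤-maxDependent a s (I-irrefl refl))
  ... | no _     = ℕ.≤-refl

  run-increasing : ∀ w s b → s b ≤ run s w b
  run-increasing [] s b = ℕ.≤-refl
  run-increasing (a ∷ w) s b = ℕ.≤-trans (step-increasing a s b) (run-increasing w (step a s) b)

  run-∉ : ∀ {b} w s → b ∉ w → run s w b ≡ s b
  run-∉ [] s b∉ = refl
  run-∉ {b} (a ∷ w) s b∉ = trans (run-∉ w (step a s) (b∉ ∘ there)) unchanged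
    where
    unchanged : step a s b ≡ s b
    unchanged with b ≟ a
    ... | yes b≡a = contradiction (here b≡a) b∉
    ... | no _    = refl

  run-independent-∈ : ∀ {b} w s → AllPairs I w → b ∈ w → run s w b ≡ suc (maxDependent b s)
  run-independent-∈ {b} (b ∷ w) s (ib ∷ _) (here refl) =
    trans (run-∉ w (step b s) (λ b∈ → I-irrefl refl (All.lookup ib b∈))) (step-self b s)
  run-independent-∈ (a ∷ w) s (ia ∷ iw) (there b∈) =
    trans (run-independent-∈ w (step a s) iw b∈) (cong suc (maxDependent-step-independent s (I-sym (All.lookup ia b∈))))

  cliqueWord-independent : ∀ {c} → IsClique c → AllPairs I (cliqueWord c)
  cliqueWord-independent {c} clique = allPairs-restrict (All.tabulate ∈-cliqueWord⁻) (cliqueWord-unique c)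
    λ {a} {b} a∈c b∈c a≢b → clique a b a∈c b∈c a≢b

  run-cliqueWord-∈ : ∀ {b c} s → IsClique c → b ∈ₛ c → run s (cliqueWord c) b ≡ suc (maxDependent b s)
  run-cliqueWord-∈ s clique b∈c = run-independent-∈ _ s (cliqueWord-independent clique) (∈-cliqueWord⁺ b∈c)

  run-cliqueWord-∉ : ∀ {b c} s → b ∉ₛ c → run s (cliqueWord c) b ≡ s b
  run-cliqueWord-∉ s b∉c = run-∉ _ s (b∉c ∘ ∈-cliqueWord⁻)

  -- s records i layers, the last of which is p; a letter b rests on them when it can start
  -- layer i + 1, i.e. there are no layers yet or b depends on a letter of p.
  Layered : ℕ → Subset n → Levels → Set
  Layered i p s = (∀ b → s b ≤ i) × (∀ {b} → b ∈ₛ p → s b ≡ i)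

  RestsOn : ℕ → Subset n → Fin n → Set
  RestsOn i p b = i ≡ 0 ⊎ ∃ λ a → a ∈ₛ p × ¬ I a b

  layered₀ : ∀ p → Layered 0 p levels₀
  layered₀ p = (λ _ → z≤n) , (λ _ → refl)

  ⟶⇒restsOn : ∀ {p c b} i → p ⟶ c → b ∈ₛ c → RestsOn i p b
  ⟶⇒restsOn {b = b} i p⟶c b∈c = inj₂ (p⟶c b b∈c)

  run-cliqueWord-≤ : ∀ {i p s c} → Layered i p s → IsClique c → ∀ b → run s (cliqueWord c) b ≤ suc i
  run-cliqueWord-≤ {i} {s = s} {c} (s≤i , _) clique b with b ∈? c
  ... | yes b∈c rewrite run-cliqueWord-∈ s clique b∈c = s≤s (maxDependent-≤ b s≤i)
  ... | no b∉c  rewrite run-cliqueWord-∉ s b∉c = ℕ.m≤n⇒m≤1+n (s≤i b)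

  run-cliqueWord-top : ∀ {i p s c b} → Layered i p s → IsClique c → b ∈ₛ c → RestsOn i p b →
                       run s (cliqueWord c) b ≡ suc i
  run-cliqueWord-top {i} {p} {s} {c} {b} (s≤i , p≡i) clique b∈c restsOn
    rewrite run-cliqueWord-∈ s clique b∈c = cong suc (ℕ.≤-antisym (maxDependent-≤ b s≤i) (i≤ restsOn))
    where
    i≤ : RestsOn i p b → i ≤ maxDependent b s
    i≤ (inj₁ refl) = z≤n
    i≤ (inj₂ (a , a∈p , ¬iab)) = subst (_≤ maxDependent b s) (p≡i a∈p) (≤-maxDependent b s (¬iab ∘ I-sym))

  layered-step : ∀ {i p s c} → Layered i p s → IsClique c → (∀ {b} → b ∈ₛ c → RestsOn i p b) →
                 Layered (suc i) c (run s (cliqueWord c))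
  layered-step layered clique restsOn =
    run-cliqueWord-≤ layered clique , λ b∈c → run-cliqueWord-top layered clique b∈c (restsOn b∈c)

  layered-run : ∀ cs {c i p s} → Layered i p s → All NonemptyClique (cs ∷ʳ c) → Linked _⟶_ (p ∷ cs ∷ʳ c) →
                ∃ λ q → Layered (i + length cs) q (run s (layersWord cs)) × q ⟶ c
  layered-run [] {i = i} {p} {s} layered _ (p⟶c ∷ _) =
    p , subst (λ j → Layered j p s) (sym (ℕ.+-identityʳ i)) layered , p⟶c
  layered-run (e ∷ cs) {i = i} {s = s} layered ((clique , _) ∷ nonempty) (p⟶e ∷ linked)
    with layered-run cs (layered-step layered clique (⟶⇒restsOn i p⟶e)) nonempty linked
  ... | q , layered′ , q⟶c = q , subst₂ (λ j t → Layered j q t) (sym (ℕ.+-suc i (length cs)))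
                                   (sym (run-++ s (cliqueWord e) (layersWord cs))) layered′ , q⟶c

  layered-prefix : ∀ cs {c} → IsLayering (cs ∷ʳ c) →
                   ∃ λ p → Layered (length cs) p (run levels₀ (layersWord cs)) × (∀ {b} → b ∈ₛ c → RestsOn (length cs) p b)
  layered-prefix [] {c} _ = c , layered₀ c , λ _ → inj₁ refl
  layered-prefix (e ∷ cs) ((clique , _) ∷ nonempty , linked)
    with layered-run cs (layered-step (layered₀ e) clique (λ _ → inj₁ refl)) nonempty linked
  ... | q , layered , q⟶c = q , subst (Layered (suc (length cs)) q) (sym (run-++ levels₀ (cliqueWord e) (layersWord cs))) layered
                              , ⟶⇒restsOn (suc (length cs)) q⟶c

  lastLayer-nonemptyClique : ∀ cs {c} → IsLayering (cs ∷ʳ c) → NonemptyClique c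
  lastLayer-nonemptyClique cs (nonempty , _) = proj₂ (All.∷ʳ⁻ nonempty)

  layersWord-∷ʳ : ∀ cs c → layersWord (cs ∷ʳ c) ≡ layersWord cs ++ cliqueWord c
  layersWord-∷ʳ cs c = trans (concatMap-++ cliqueWord cs (c ∷ [])) (cong (layersWord cs ++_) (++-identityʳ (cliqueWord c)))

  length-∷ʳ : ∀ {A : Set} (xs : List A) x → length (xs ∷ʳ x) ≡ suc (length xs)
  length-∷ʳ xs x = trans (length-++ xs) (ℕ.+-comm (length xs) 1)

  height-enlargeLast : ∀ cs {c c′} → IsLayering (cs ∷ʳ c) → IsClique c′ → c ⊆ₛ c′ →
                       height (layersWord cs ++ cliqueWord c′) ≡ suc (length cs)
  height-enlargeLast cs {c} {c′} layering clique′ c⊆c′ with layered-prefix cs layering | lastLayer-nonemptyClique cs layering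
  ... | p , layered , restsOn | _ , b , b∈c = ℕ.≤-antisym
    (maxOf-≤ λ x → subst (_≤ suc (length cs)) (sym (at x)) (run-cliqueWord-≤ layered clique′ x))
    (subst (_≤ height (layersWord cs ++ cliqueWord c′))
      (trans (at b) (run-cliqueWord-top layered clique′ (c⊆c′ b∈c) (restsOn b∈c))) (≤-maxOf _ b))
    where
    at : ∀ x → run levels₀ (layersWord cs ++ cliqueWord c′) x ≡ run (run levels₀ (layersWord cs)) (cliqueWord c′) x
    at x = cong (λ t → t x) (run-++ levels₀ (layersWord cs) (cliqueWord c′))

  height-layering : ∀ cs → IsLayering cs → height (layersWord cs) ≡ length cs
  height-layering cs layering with initLast cs
  ... | [] = ℕ.n≤0⇒n≡0 (maxOf-≤ λ _ → z≤n)
  ... | cs′ ∷ʳ′ c = trans (cong height (layersWord-∷ʳ cs′ c))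
      (trans (height-enlargeLast cs′ layering (proj₁ (lastLayer-nonemptyClique cs′ layering)) ⊆-refl)
             (sym (length-∷ʳ cs′ c)))

  hasHeight⇒height : ∀ {u k} → HasHeight u k → height u ≡ k
  hasHeight⇒height (cs , isCF , refl) = trans (height-resp-~ (proj₁ isCF)) (height-layering cs (isCF⇒isLayering isCF))

  height-dependentAfterLast : ∀ cs {c a b} z → IsLayering (cs ∷ʳ c) → a ∈ₛ c → ¬ I a b →
                              suc (suc (length cs)) ≤ height (layersWord cs ++ cliqueWord c ++ b ∷ z)
  height-dependentAfterLast cs {c} {a} {b} z layering a∈c ¬iab with layered-prefix cs layering | lastLayer-nonemptyClique cs layering
  ... | p , layered , restsOn | clique , _ = begin
    suc (suc (length cs))       ≤⟨ s≤s (subst (_≤ maxDependent b T) Ta (≤-maxDependent b T (¬iab ∘ I-sym))) ⟩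
    suc (maxDependent b T)      ≡⟨ sym (step-self b T) ⟩
    step b T b                  ≤⟨ run-increasing z (step b T) b ⟩
    run (step b T) z b          ≡⟨ sym runAt ⟩
    run levels₀ (layersWord cs ++ cliqueWord c ++ b ∷ z) b ≤⟨ ≤-maxOf _ b ⟩
    height (layersWord cs ++ cliqueWord c ++ b ∷ z) ∎
    where
    open ℕ.≤-Reasoning
    S T : Levels
    S = run levels₀ (layersWord cs)
    T = run S (cliqueWord c)
    Ta : T a ≡ suc (length cs)
    Ta = run-cliqueWord-top layered clique a∈c (restsOn a∈c)
    runAt : run levels₀ (layersWord cs ++ cliqueWord c ++ b ∷ z) b ≡ run (step b T) z b
    runAt = trans (cong (λ t → t b) (run-++ levels₀ (layersWord cs) (cliqueWord c ++ b ∷ z)))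
                  (cong (λ t → t b) (run-++ S (cliqueWord c) (b ∷ z)))

  -- Enumerating the traces of a given height

  _~?_ : Decidable _~_
  u ~? v = map′ ≃⇒~ ~⇒≃ (u ≃? v)

  ~-decSetoid : DecSetoid 0ℓ 0ℓ
  ~-decSetoid = record
    { Carrier = Word
    ; _≈_ = _~_
    ; isDecEquivalence = record
      { isEquivalence = record { refl = ~refl ; sym = ~sym ; trans = ~trans }
      ; _≟_ = _~?_ } }

  isLayering? : ∀ cs → Dec (IsLayering cs)
  isLayering? cs = All.all? (λ c → isClique? c ×-dec nonempty? c) cs ×-dec Linked.linked? _⟶?_ cs
    where
    _⟶?_ : ∀ c c′ → Dec (c ⟶ c′)
    c ⟶? c′ = all? λ b → (b ∈? c′) →-dec any? λ a → (a ∈? c) ×-dec ¬? (I? a b)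

  sequences : ℕ → List (List (Subset n))
  sequences zero    = [] ∷ []
  sequences (suc k) = cartesianProductWith _∷_ (allSubsets n) (sequences k)

  ∈-sequences : ∀ cs → cs ∈ sequences (length cs)
  ∈-sequences []       = here refl
  ∈-sequences (c ∷ cs) = ∈-cartesianProductWith⁺ _∷_ (∈-allSubsets c) (∈-sequences cs)

  length-∈-sequences : ∀ k {cs} → cs ∈ sequences k → length cs ≡ k
  length-∈-sequences zero    (here refl) = refl
  length-∈-sequences (suc k) cs∈ with ∈-cartesianProductWith⁻ _∷_ (allSubsets n) (sequences k) cs∈
  ... | _ , _ , _ , cs′∈ , refl = cong suc (length-∈-sequences k cs′∈)

  tracesOfHeight : ℕ → List Word
  tracesOfHeight k = deduplicate _~?_ (map layersWord (filter isLayering? (sequences k)))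

  ∈-tracesOfHeight⁻ : ∀ {k x} → x ∈ tracesOfHeight k → ∃ λ cs → x ≡ layersWord cs × IsLayering cs × length cs ≡ k
  ∈-tracesOfHeight⁻ {k} x∈ with ∈-map⁻ layersWord (Any.deduplicate⁻ _~?_ x∈)
  ... | cs , cs∈ , refl with ∈-filter⁻ isLayering? {xs = sequences k} cs∈
  ...   | cs∈′ , layering = cs , refl , layering , length-∈-sequences k cs∈′

  tracesOfHeight-complete : ∀ {cs} → IsLayering cs → Any (layersWord cs ~_) (tracesOfHeight (length cs))
  tracesOfHeight-complete {cs} layering = Any.deduplicate⁺ _~?_ (λ y~x x~ → ~trans x~ (~sym y~x))
    (Any.map (λ { refl → ~refl }) (∈-map⁺ layersWord (∈-filter⁺ isLayering? (∈-sequences cs) layering)))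

  tracesOfHeight-distinct : ∀ k → AllPairs (λ x y → ¬ x ~ y) (tracesOfHeight k)
  tracesOfHeight-distinct k = deduplicate-! ~-decSetoid _

  height-∈-tracesOfHeight : ∀ {k x} → x ∈ tracesOfHeight k → height x ≡ k
  height-∈-tracesOfHeight {k} x∈ with ∈-tracesOfHeight⁻ {k} x∈
  ... | cs , refl , layering , refl = height-layering cs layering

  aboveAtHeight : Word → ℕ → List Word
  aboveAtHeight u k = filter (u ≤ₜ?_) (tracesOfHeight k)

  aboveAtHeight-distinct : ∀ u k → AllPairs (λ x y → ¬ x ~ y) (aboveAtHeight u k)
  aboveAtHeight-distinct u k = UniqueSetoid.filter⁺ (DecSetoid.setoid ~-decSetoid) (u ≤ₜ?_) (tracesOfHeight-distinct k)

  𝓜 : Word → List Word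
  𝓜 u = aboveAtHeight u (length (cartierFoata u))

  𝓜-enumerates : ∀ a w → IsEnumeration (InM (a ∷ w)) (𝓜 (a ∷ w))
  𝓜-enumerates a w = All.tabulate sound , complete , aboveAtHeight-distinct u k
    where
    u : Word
    u = a ∷ w
    k : ℕ
    k = length (cartierFoata u)
    u-height : HasHeight u k
    u-height = cartierFoata u , cartierFoata-isCF u , refl
    sound : ∀ {x} → x ∈ 𝓜 u → InM u x
    sound x∈ with ∈-filter⁻ (u ≤ₜ?_) {xs = tracesOfHeight k} x∈
    ... | x∈′ , u≤x with ∈-tracesOfHeight⁻ x∈′
    ...   | cs , refl , layering , |cs|≡k = (k , u-height , cs , (~refl , layering) , |cs|≡k) , u≤x
    complete : ∀ x → InM u x → Any (x ~_) (𝓜 u)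
    complete x ((j , u-height′ , cs , isCF , refl) , u≤x)
      with find (tracesOfHeight-complete (isCF⇒isLayering isCF))
    ... | z , z∈ , cs~z = Any.map (λ { refl → x~z }) (∈-filter⁺ (u ≤ₜ?_) z∈′ (≤ₜ-respʳ-≃ (~⇒≃ x~z) u≤x))
      where
      x~z : x ~ z
      x~z = ~trans (proj₁ isCF) cs~z
      z∈′ : z ∈ tracesOfHeight k
      z∈′ = subst (λ j → z ∈ tracesOfHeight j) (trans (sym (hasHeight⇒height u-height′)) (hasHeight⇒height u-height)) z∈

  isCF-resp-~ : ∀ {u u′ cs} → u ~ u′ → IsCF u cs → IsCF u′ cs
  isCF-resp-~ u~u′ (u~cs , layering) = ~trans (~sym u~u′) u~cs , layering

  lastLayerView : ∀ a w → ∃ λ cs → ∃ λ c → IsCF (a ∷ w) (cs ∷ʳ c) × length (cartierFoata (a ∷ w)) ≡ suc (length cs)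
  lastLayerView a w with ∷⇒∷ʳ (minimalLetters (a ∷ w)) (peel (length w) (peelOff (a ∷ w)))
  ... | cs , c , eq = cs , c , subst (IsCF (a ∷ w)) eq (cartierFoata-isCF (a ∷ w)) , trans (cong length eq) (length-∷ʳ cs c)

  -- Fix a trace u with Cartier–Foata decomposition cs ∷ʳ c and write v for the trace of cs.
  -- Traces x above u of the same height are classified by the first layer of x ÷ v.
  module LastLayer {u cs c} (isCF : IsCF u (cs ∷ʳ c)) where

    v : Word
    v = layersWord cs

    K : ℕ
    K = suc (length cs)

    layering : IsLayering (cs ∷ʳ c)
    layering = isCF⇒isLayering isCF

    c-isClique : IsClique c
    c-isClique = proj₁ (lastLayer-nonemptyClique cs layering)

    u≃v++c : u ≃ v ++ cliqueWord c
    u≃v++c = ≃-trans (~⇒≃ (proj₁ isCF)) (≡⇒≃ (layersWord-∷ʳ cs c))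

    nextLayer : Word → Subset n
    nextLayer x = minimalLetters (x ÷ v)

    nextLayer-resp-≃ : ∀ {x x′} → x ≃ x′ → nextLayer x ≡ nextLayer x′
    nextLayer-resp-≃ p = minimalLetters-resp-≃ (÷-cong-≃ v p)

    ÷-prefix : ∀ {c′ x} w → x ~ ((v ++ cliqueWord c′) ++ w) → x ÷ v ≃ cliqueWord c′ ++ w
    ÷-prefix {c′} {x} w x~ = subst (x ÷ v ≃_) (++-÷ v (cliqueWord c′ ++ w))
      (÷-cong-≃ v (≃-trans (~⇒≃ x~) (≡⇒≃ (++-assoc v (cliqueWord c′) w))))

    ⊆-nextLayer : ∀ {c′ x} → IsClique c′ → (v ++ cliqueWord c′) ≤ₜ x → c′ ⊆ₛ nextLayer x
    ⊆-nextLayer {x = x} clique′ (w , x~) a∈c′ =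
      ∈-minimalLetters⁺ (Minimal-resp-≃ (≃-sym (÷-prefix w x~)) (Minimal-cliqueWord w clique′ a∈c′))

    ≃-v++÷v : ∀ {x} → u ≤ₜ x → x ≃ v ++ x ÷ v
    ≃-v++÷v {x} u≤x with ≤ₜ-respˡ-≃ u≃v++c u≤x
    ... | w , x~ = ≃-trans (~⇒≃ x~) (≃-trans (≡⇒≃ (++-assoc v (cliqueWord c) w))
                     (++-congˡ-≃ v (≃-sym (÷-prefix w x~))))

    ⊆-nextLayer⇒≤ₜ : ∀ {c′ x} → IsClique c′ → u ≤ₜ x → c′ ⊆ₛ nextLayer x → (v ++ cliqueWord c′) ≤ₜ x
    ⊆-nextLayer⇒≤ₜ {c′} {x} clique′ u≤x c′⊆ = x ÷ v ÷ cliqueWord c′ , ≃⇒~ (≃-trans (≃-v++÷v u≤x)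
      (≃-trans (++-congˡ-≃ v (pullClique (x ÷ v) clique′ (λ a∈c′ → ∈-minimalLetters⁻ (x ÷ v) (c′⊆ a∈c′))))
        (≡⇒≃ (sym (++-assoc v (cliqueWord c′) (x ÷ v ÷ cliqueWord c′))))))

    ≤ₜ-enlargeLast : ∀ {c′} → IsClique c′ → c ⊆ₛ c′ → u ≤ₜ (v ++ cliqueWord c′)
    ≤ₜ-enlargeLast {c′} clique′ c⊆c′ = ≤ₜ-respˡ-≃ (≃-sym u≃v++c) (cliqueWord c′ ÷ cliqueWord c , ≃⇒~
      (≃-trans (++-congˡ-≃ v (pullClique (cliqueWord c′) c-isClique minimalInC′))
        (≡⇒≃ (sym (++-assoc v (cliqueWord c) (cliqueWord c′ ÷ cliqueWord c))))))
      where
      minimalInC′ : ∀ {a} → a ∈ₛ c → Minimal a (cliqueWord c′)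
      minimalInC′ a∈c = subst (Minimal _) (++-identityʳ (cliqueWord c′)) (Minimal-cliqueWord [] clique′ (c⊆c′ a∈c))

    nextLayer-u : nextLayer u ≡ c
    nextLayer-u = trans (nextLayer-resp-≃ u≃v++c)
      (trans (cong minimalLetters (++-÷ v (cliqueWord c))) (minimalLetters-cliqueWord c-isClique))

    -- Above u and at the height of u, only u itself has next layer c: a letter after c
    -- either depends on c and raises the height, or is independent of c and minimal.
    nextLayer≡c⇒≃u : ∀ {x} → u ≤ₜ x → nextLayer x ≡ c → height x ≡ K → x ≃ u
    nextLayer≡c⇒≃u {x} u≤x next≡c height≡K = ≃-trans (byRest (x ÷ v ÷ cliqueWord c) pulled) (≃-sym u≃v++c)
      where
      pulled : x ÷ v ≃ cliqueWord c ++ x ÷ v ÷ cliqueWord c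
      pulled = pullClique (x ÷ v) c-isClique (λ a∈c → ∈-minimalLetters⁻ (x ÷ v) (subst (_ ∈ₛ_) (sym next≡c) a∈c))
      byRest : ∀ r → x ÷ v ≃ cliqueWord c ++ r → x ≃ v ++ cliqueWord c
      byRest [] p = ≃-trans (≃-v++÷v u≤x) (++-congˡ-≃ v (≃-trans p (≡⇒≃ (++-identityʳ (cliqueWord c)))))
      byRest (b ∷ r) p with any? (λ a → (a ∈? c) ×-dec ¬? (I? a b))
      ... | yes (a , a∈c , ¬iab) = contradiction (subst (suc K ≤_) (trans (sym (height-resp-~ (≃⇒~ x≃))) height≡K)
                                      (height-dependentAfterLast cs r layering a∈c ¬iab)) (ℕ.<-irrefl refl)
        where
        x≃ : x ≃ v ++ cliqueWord c ++ b ∷ r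
        x≃ = ≃-trans (≃-v++÷v u≤x) (++-congˡ-≃ v p)
      ... | no none = contradiction (independent b b∈c) (I-irrefl refl)
        where
        independent : ∀ a → a ∈ₛ c → I a b
        independent a a∈c with I? a b
        ... | yes i = i
        ... | no ¬i = contradiction (a , a∈c , ¬i) none
        b∈c : b ∈ₛ c
        b∈c = subst (b ∈ₛ_) next≡c (∈-minimalLetters⁺ (Minimal-resp-≃ (≃-sym p) (Minimal-skip independent (Minimal-head b r))))

module Inversion {n : ℕ} (I : Rel (Fin n) 0ℓ) (I? : Decidable I) (I-sym : Symmetric I) (I-irrefl : Irreflexive _≡_ I)
                 {ℓc ℓ : Level} (G : AbelianGroup ℓc ℓ) (F H : Trace.Word I I? → AbelianGroup.Carrier G)
                 (F-resp-~ : ∀ u v → Trace._~_ I I? u v → AbelianGroup._≈_ G (F u) (F v))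
                 (mobius : Trace.IsGradedMobius I I? G F H) where
  open Trace I I?
  open TraceTheory I I? I-sym I-irrefl
  open AbelianGroup G renaming (refl to ≈-refl; sym to ≈-sym; trans to ≈-trans; reflexive to ≈-reflexive)
  open FiniteSums G
  open import Relation.Binary.Reasoning.Setoid setoid

  H-resp-~ : ∀ {u u′} → u ~ u′ → H u ≈ H u′
  H-resp-~ {[]} {u′} u~u′ with ≃[]⇒≡[] u′ (~⇒≃ u~u′)
  ... | refl = ≈-refl
  H-resp-~ {a ∷ w} {u′} u~u′ with lastLayerView a w
  ... | cs , c , isCF , _ = ≈-trans (proj₁ mobius (a ∷ w) cs c isCF) (≈-sym (proj₁ mobius u′ cs c (isCF-resp-~ u~u′ isCF)))

  cliquesAbove : Subset n → List (Subset n)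
  cliquesAbove c = filter (c ⊆?_) cliques

  -- Möbius inversion on the Boolean lattice of cliques between c and M.
  ∑-cliquesAbove : ∀ {c M} → IsClique M → ∀ g →
    ∑ (λ c′ → signed (∣ c′ ∣ ∸ ∣ c ∣) (when (c′ ⊆? M) g)) (cliquesAbove c) ≈ when (c ≟ₛ M) g
  ∑-cliquesAbove {c} {M} clique g = begin
    ∑ term (filter (c ⊆?_) (filter isClique? (allSubsets n)))
      ≈⟨ ∑-filter (c ⊆?_) term (filter isClique? (allSubsets n)) ⟩
    ∑ (λ S → when (c ⊆? S) (term S)) (filter isClique? (allSubsets n))
      ≈⟨ ∑-filter isClique? (λ S → when (c ⊆? S) (term S)) (allSubsets n) ⟩
    ∑ (λ S → when (isClique? S) (when (c ⊆? S) (term S))) (allSubsets n)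
      ≈⟨ ∑-cong (allSubsets n) (λ {S} _ → pointwise S (isClique? S) (c ⊆? S) (S ⊆? M)) ⟩
    ∑ (intervalTerm c M ∣ c ∣ g) (allSubsets n)
      ≈⟨ ∑-interval c M ∣ c ∣ g ⟩
    when (c ≟ₛ M) (signed (∣ c ∣ + ∣ c ∣) g)
      ≈⟨ when-signed-double (c ≟ₛ M) ∣ c ∣ g ⟩
    when (c ≟ₛ M) g ∎
    where
    term : Subset n → Carrier
    term c′ = signed (∣ c′ ∣ ∸ ∣ c ∣) (when (c′ ⊆? M) g)
    pointwise : ∀ S → (S? : Dec (IsClique S)) (c⊆? : Dec (c ⊆ₛ S)) (⊆M? : Dec (S ⊆ₛ M)) →
      when S? (when c⊆? (signed (∣ S ∣ ∸ ∣ c ∣) (when ⊆M? g))) ≈ when c⊆? (when ⊆M? (signed (∣ c ∣ + ∣ S ∣) g))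
    pointwise S (yes _) (yes c⊆S) (yes _)  = signed-∸ (p⊆q⇒∣p∣≤∣q∣ c⊆S) g
    pointwise S (yes _) (yes _)   (no _)   = signed-ε (∣ S ∣ ∸ ∣ c ∣)
    pointwise S (yes _) (no _)    _        = ≈-refl
    pointwise S (no ¬clique) _ (yes S⊆M)   = contradiction (⊆-isClique clique S⊆M) ¬clique
    pointwise S (no _) (yes _)    (no _)   = ≈-refl
    pointwise S (no _) (no _)     (no _)   = ≈-refl

  ∑-cliquesBelow : ∀ {c′} → IsClique c′ → ∀ g →
    ∑ (λ c → when (c ⊆? c′) (signed (∣ c′ ∣ ∸ ∣ c ∣) g)) cliques ≈ when (⊥ ≟ₛ c′) g
  ∑-cliquesBelow {c′} clique′ g = begin
    ∑ term (filter isClique? (allSubsets n))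
      ≈⟨ ∑-filter isClique? term (allSubsets n) ⟩
    ∑ (λ S → when (isClique? S) (term S)) (allSubsets n)
      ≈⟨ ∑-cong (allSubsets n) (λ {S} _ → ≈-trans (pointwise S (isClique? S) (S ⊆? c′)) (≈-sym (when-yes (⊥ ⊆? S) _ (⊆-min S)))) ⟩
    ∑ (intervalTerm ⊥ c′ ∣ c′ ∣ g) (allSubsets n)
      ≈⟨ ∑-interval ⊥ c′ ∣ c′ ∣ g ⟩
    when (⊥ ≟ₛ c′) (signed (∣ c′ ∣ + ∣ ⊥ {n} ∣) g)
      ≈⟨ atBottom (⊥ ≟ₛ c′) ⟩
    when (⊥ ≟ₛ c′) g ∎
    where
    term : Subset n → Carrier
    term c = when (c ⊆? c′) (signed (∣ c′ ∣ ∸ ∣ c ∣) g)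
    pointwise : ∀ S → (S? : Dec (IsClique S)) (⊆c′? : Dec (S ⊆ₛ c′)) →
      when S? (when ⊆c′? (signed (∣ c′ ∣ ∸ ∣ S ∣) g)) ≈ when ⊆c′? (signed (∣ c′ ∣ + ∣ S ∣) g)
    pointwise S (yes _) (yes S⊆c′) = ≈-trans (signed-∸ (p⊆q⇒∣p∣≤∣q∣ S⊆c′) g)
                                       (≈-reflexive (cong (λ k → signed k g) (ℕ.+-comm ∣ S ∣ ∣ c′ ∣)))
    pointwise S (no ¬clique) (yes S⊆c′) = contradiction (⊆-isClique clique′ S⊆c′) ¬clique
    pointwise S (yes _) (no _) = ≈-refl
    pointwise S (no _)  (no _) = ≈-refl
    atBottom : (d : Dec (⊥ ≡ c′)) → when d (signed (∣ c′ ∣ + ∣ ⊥ {n} ∣) g) ≈ when d g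
    atBottom d@(yes refl) = when-signed-double d ∣ ⊥ {n} ∣ g
    atBottom (no _)         = ≈-refl

  cliqueWords-enumerate : IsEnumeration (InM []) (map cliqueWord cliques)
  cliqueWords-enumerate = sound , complete , distinct
    where
    sound : All (InM []) (map cliqueWord cliques)
    sound = All.map⁺ (All.map (λ clique → _ , clique , ~refl) cliques-isClique)
    complete : ∀ x → InM [] x → Any (x ~_) (map cliqueWord cliques)
    complete x (c , clique , x~c) = Any.map (λ { refl → x~c }) (∈-map⁺ cliqueWord (∈-cliques clique))
    distinct : AllPairs (λ x y → ¬ x ~ y) (map cliqueWord cliques)
    distinct = AllPairs.map⁺ (allPairs-restrict cliques-isClique cliques-unique
      λ clique clique′ c≢c′ c~c′ → c≢c′ (trans (sym (minimalLetters-cliqueWord clique))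
        (trans (minimalLetters-resp-≃ (~⇒≃ c~c′)) (minimalLetters-cliqueWord clique′))))

  H-cliqueWord : ∀ {c} → IsClique c →
    H (cliqueWord c) ≈ ∑ (λ c′ → signed (∣ c′ ∣ ∸ ∣ c ∣) (F (cliqueWord c′))) (cliquesAbove c)
  H-cliqueWord {c} clique with nonempty? c
  ... | yes nonempty = proj₁ mobius (cliqueWord c) [] c
          (≃⇒~ (≡⇒≃ (sym (++-identityʳ (cliqueWord c)))) , (clique , nonempty) ∷ [] , [-])
  ... | no empty with Empty-unique empty
  ...   | refl = begin
    H (cliqueWord ⊥)                                         ≡⟨ cong H cliqueWord-⊥ ⟩
    H []                                                     ≈⟨ proj₂ mobius ⟩
    ∑ (λ c′ → signed ∣ c′ ∣ (F (cliqueWord c′))) cliques     ≡⟨ sym allAbove ⟩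
    ∑ (λ c′ → signed (∣ c′ ∣ ∸ ∣ ⊥ {n} ∣) (F (cliqueWord c′))) (cliquesAbove ⊥) ∎
    where
    allAbove : ∑ (λ c′ → signed (∣ c′ ∣ ∸ ∣ ⊥ {n} ∣) (F (cliqueWord c′))) (cliquesAbove ⊥)
             ≡ ∑ (λ c′ → signed ∣ c′ ∣ (F (cliqueWord c′))) cliques
    allAbove rewrite ∣⊥∣≡0 n = cong (∑ (λ c′ → signed ∣ c′ ∣ (F (cliqueWord c′))))
                                    (filter-all (⊥ ⊆?_) {cliques} (All.tabulate λ {c′} _ → ⊆-min c′))

  F[]≈∑H : F [] ≈ ∑ H (map cliqueWord cliques)
  F[]≈∑H = ≈-sym (begin
    ∑ H (map cliqueWord cliques)
      ≡⟨ ∑-map H cliqueWord cliques ⟩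
    ∑ (λ c → H (cliqueWord c)) cliques
      ≈⟨ ∑-cong cliques (λ c∈ → H-cliqueWord (All.lookup cliques-isClique c∈)) ⟩
    ∑ (λ c → ∑ (λ c′ → signed (∣ c′ ∣ ∸ ∣ c ∣) (F (cliqueWord c′))) (cliquesAbove c)) cliques
      ≈⟨ ∑-cong cliques (λ {c} _ → ∑-filter (c ⊆?_) (λ c′ → signed (∣ c′ ∣ ∸ ∣ c ∣) (F (cliqueWord c′))) cliques) ⟩
    ∑ (λ c → ∑ (term c) cliques) cliques
      ≈⟨ ∑-comm term cliques cliques ⟩
    ∑ (λ c′ → ∑ (λ c → term c c′) cliques) cliques
      ≈⟨ ∑-cong cliques (λ {c′} c′∈ → ∑-cliquesBelow (All.lookup cliques-isClique c′∈) (F (cliqueWord c′))) ⟩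
    ∑ (λ c′ → when (⊥ ≟ₛ c′) (F (cliqueWord c′))) cliques
      ≈⟨ ∑-when-single (⊥ ≟ₛ_) (λ c′ → F (cliqueWord c′)) cliques-unique (λ _ _ ⊥≡x ⊥≡y x≢y → x≢y (trans (sym ⊥≡x) ⊥≡y))
           (∈-cliques (λ a _ a∈⊥ → contradiction a∈⊥ ∉⊥)) refl ⟩
    F (cliqueWord ⊥)
      ≡⟨ cong F cliqueWord-⊥ ⟩
    F [] ∎)
    where
    term : Subset n → Subset n → Carrier
    term c c′ = when (c ⊆? c′) (signed (∣ c′ ∣ ∸ ∣ c ∣) (F (cliqueWord c′)))

  module Step {u cs c} (isCF : IsCF u (cs ∷ʳ c)) (|cf|≡K : length (cartierFoata u) ≡ suc (length cs))
              (IH : ∀ y → y ≢ [] → length (𝓜 y) < length (𝓜 u) → F y ≈ ∑ H (𝓜 y)) where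
    open LastLayer isCF

    E : List Word
    E = aboveAtHeight u K

    𝓜u≡E : 𝓜 u ≡ E
    𝓜u≡E = cong (aboveAtHeight u) |cf|≡K

    ∈-E⁻ : ∀ {x} → x ∈ E → x ∈ tracesOfHeight K × u ≤ₜ x
    ∈-E⁻ = ∈-filter⁻ (u ≤ₜ?_) {xs = tracesOfHeight K}

    representative : ∃ λ z → z ∈ tracesOfHeight K × u ~ z
    representative with find (tracesOfHeight-complete layering)
    ... | z , z∈ , cs~z = z , subst (λ k → z ∈ tracesOfHeight k) (length-∷ʳ cs c) z∈ , ~trans (proj₁ isCF) cs~z

    z : Word
    z = proj₁ representative

    u~z : u ~ z
    u~z = proj₂ (proj₂ representative)

    z∈E : z ∈ E
    z∈E = ∈-filter⁺ (u ≤ₜ?_) (proj₁ (proj₂ representative)) (≤ₜ-reflexive (~⇒≃ u~z))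

    nextLayer-z : nextLayer z ≡ c
    nextLayer-z = trans (sym (nextLayer-resp-≃ (~⇒≃ u~z))) nextLayer-u

    L : List (Subset n)
    L = cliquesAbove c

    ∈-L⁻ : ∀ {c′} → c′ ∈ L → IsClique c′ × c ⊆ₛ c′
    ∈-L⁻ c′∈ with ∈-filter⁻ (c ⊆?_) {xs = cliques} c′∈
    ... | c′∈cliques , c⊆c′ = All.lookup cliques-isClique c′∈cliques , c⊆c′

    c∈L : c ∈ L
    c∈L = ∈-filter⁺ (c ⊆?_) (∈-cliques c-isClique) ⊆-refl

    sign : Subset n → ℕ
    sign c′ = ∣ c′ ∣ ∸ ∣ c ∣

    φ ψ : Subset n → Carrier
    φ c′ = F (v ++ cliqueWord c′)
    ψ c′ = ∑ (λ x → when (c′ ⊆? nextLayer x) (H x)) E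

    selects : ∀ {c′} → IsClique c′ → c ⊆ₛ c′ → ∀ x →
      when ((v ++ cliqueWord c′) ≤ₜ? x) (H x) ≈ when (u ≤ₜ? x) (when (c′ ⊆? nextLayer x) (H x))
    selects {c′} clique′ c⊆c′ x with (v ++ cliqueWord c′) ≤ₜ? x | u ≤ₜ? x | c′ ⊆? nextLayer x
    ... | yes _   | yes _   | yes _  = ≈-refl
    ... | yes y≤x | yes _   | no c′⊈  = ⊥-elim (c′⊈ (⊆-nextLayer clique′ y≤x))
    ... | no ¬y≤x | yes u≤x | yes c′⊆  = contradiction (⊆-nextLayer⇒≤ₜ clique′ u≤x c′⊆) ¬y≤x
    ... | no _    | yes _   | no _   = ≈-refl
    ... | yes y≤x | no ¬u≤x | _      = contradiction (≤ₜ-trans (≤ₜ-enlargeLast clique′ c⊆c′) y≤x) ¬u≤x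
    ... | no _    | no _    | _      = ≈-refl

    height-enlarged : ∀ {c′} → IsClique c′ → c ⊆ₛ c′ → length (cartierFoata (v ++ cliqueWord c′)) ≡ K
    height-enlarged {c′} clique′ c⊆c′ = trans (sym (hasHeight⇒height (_ , cartierFoata-isCF (v ++ cliqueWord c′) , refl)))
                                                (height-enlargeLast cs layering clique′ c⊆c′)

    ∑-𝓜-enlarged : ∀ {c′} → IsClique c′ → c ⊆ₛ c′ → ∑ H (𝓜 (v ++ cliqueWord c′)) ≈ ψ c′
    ∑-𝓜-enlarged {c′} clique′ c⊆c′ = begin
      ∑ H (𝓜 (v ++ cliqueWord c′))
        ≡⟨ cong (λ k → ∑ H (aboveAtHeight (v ++ cliqueWord c′) k)) (height-enlarged clique′ c⊆c′) ⟩
      ∑ H (aboveAtHeight (v ++ cliqueWord c′) K)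
        ≈⟨ ∑-filter ((v ++ cliqueWord c′) ≤ₜ?_) H (tracesOfHeight K) ⟩
      ∑ (λ x → when ((v ++ cliqueWord c′) ≤ₜ? x) (H x)) (tracesOfHeight K)
        ≈⟨ ∑-cong (tracesOfHeight K) (λ {x} _ → selects clique′ c⊆c′ x) ⟩
      ∑ (λ x → when (u ≤ₜ? x) (when (c′ ⊆? nextLayer x) (H x))) (tracesOfHeight K)
        ≈⟨ ≈-sym (∑-filter (u ≤ₜ?_) (λ x → when (c′ ⊆? nextLayer x) (H x)) (tracesOfHeight K)) ⟩
      ψ c′ ∎

    𝓜-enlarged-shorter : ∀ {c′} → IsClique c′ → c ⊆ₛ c′ → c′ ≢ c → length (𝓜 (v ++ cliqueWord c′)) < length (𝓜 u)
    𝓜-enlarged-shorter {c′} clique′ c⊆c′ c′≢c =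
      subst₂ (λ k k′ → length (aboveAtHeight (v ++ cliqueWord c′) k) < length (aboveAtHeight u k′))
        (sym (height-enlarged clique′ c⊆c′)) (sym |cf|≡K)
        (length-filter-< ((v ++ cliqueWord c′) ≤ₜ?_) (u ≤ₜ?_) (tracesOfHeight K)
          (≤ₜ-trans (≤ₜ-enlargeLast clique′ c⊆c′))
          (Any.map (λ { refl → proj₂ (∈-E⁻ z∈E) , z-not-above }) (proj₁ (∈-E⁻ z∈E))))
      where
      z-not-above : ¬ (v ++ cliqueWord c′) ≤ₜ z
      z-not-above y≤z = c′≢c (⊆-antisym (subst (c′ ⊆ₛ_) nextLayer-z (⊆-nextLayer clique′ y≤z)) c⊆c′)

    φ≈ψ : ∀ {c′} → c′ ∈ L → c′ ≢ c → φ c′ ≈ ψ c′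
    φ≈ψ {c′} c′∈ c′≢c with ∈-L⁻ c′∈
    ... | clique′ , c⊆c′ with lastLayer-nonemptyClique cs layering
    ...   | _ , b , b∈c = ≈-trans (IH (v ++ cliqueWord c′) (∈⇒≢[] (∈-++⁺ʳ v (∈-cliqueWord⁺ (c⊆c′ b∈c))))
                                  (𝓜-enlarged-shorter clique′ c⊆c′ c′≢c))
                                (∑-𝓜-enlarged clique′ c⊆c′)

    ψ-c : ψ c ≈ ∑ H E
    ψ-c = ∑-cong E λ x∈ → when-yes (c ⊆? _) _ (⊆-nextLayer c-isClique (≤ₜ-respˡ-≃ u≃v++c (proj₂ (∈-E⁻ x∈))))

    ∑ψ≈Hu : ∑ (λ c′ → signed (sign c′) (ψ c′)) L ≈ H u
    ∑ψ≈Hu = begin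
      ∑ (λ c′ → signed (sign c′) (ψ c′)) L
        ≈⟨ ∑-cong L (λ {c′} _ → signed-∑ (sign c′) (λ x → when (c′ ⊆? nextLayer x) (H x)) E) ⟩
      ∑ (λ c′ → ∑ (λ x → term x c′) E) L
        ≈⟨ ∑-comm (λ c′ x → term x c′) L E ⟩
      ∑ (λ x → ∑ (term x) L) E
        ≈⟨ ∑-cong E (λ {x} _ → ∑-cliquesAbove (minimalLetters-isClique (x ÷ v)) (H x)) ⟩
      ∑ (λ x → when (c ≟ₛ nextLayer x) (H x)) E
        ≈⟨ ∑-when-single (λ x → c ≟ₛ nextLayer x) H (aboveAtHeight-distinct u K) onlyU z∈E (sym nextLayer-z) ⟩
      H z
        ≈⟨ H-resp-~ (~sym u~z) ⟩
      H u ∎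
      where
      term : Word → Subset n → Carrier
      term x c′ = signed (sign c′) (when (c′ ⊆? nextLayer x) (H x))
      ≃u : ∀ {x} → x ∈ E → c ≡ nextLayer x → x ≃ u
      ≃u x∈ c≡ = nextLayer≡c⇒≃u (proj₂ (∈-E⁻ x∈)) (sym c≡) (height-∈-tracesOfHeight (proj₁ (∈-E⁻ x∈)))
      onlyU : ∀ {x y} → x ∈ E → y ∈ E → c ≡ nextLayer x → c ≡ nextLayer y → ¬ ¬ x ~ y
      onlyU x∈ y∈ cx cy ¬x~y = ¬x~y (≃⇒~ (≃-trans (≃u x∈ cx) (≃-sym (≃u y∈ cy))))

    -- Both alternating sums over L equal H u, and their terms agree away from c.
    φ-c≈ψ-c : φ c ≈ ψ c
    φ-c≈ψ-c = unsign (∑-cancel-others L (λ c′ → signed (sign c′) (φ c′)) (λ c′ → signed (sign c′) (ψ c′))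
      cliquesAbove-unique c∈L (λ {c′} c′∈ c′≢c → signed-cong (sign c′) (φ≈ψ c′∈ c′≢c))
      (≈-trans (≈-sym (proj₁ mobius u cs c isCF)) (≈-sym ∑ψ≈Hu)))
      where
      cliquesAbove-unique : Unique L
      cliquesAbove-unique = Unique.filter⁺ (c ⊆?_) cliques-unique
      unsign : ∀ {a b} → signed (sign c) a ≈ signed (sign c) b → a ≈ b
      unsign rewrite ℕ.n∸n≡0 ∣ c ∣ = λ p → p

    F-u : F u ≈ ∑ H (𝓜 u)
    F-u = begin
      F u       ≈⟨ F-resp-~ u _ (≃⇒~ u≃v++c) ⟩
      φ c       ≈⟨ φ-c≈ψ-c ⟩
      ψ c       ≈⟨ ψ-c ⟩
      ∑ H E     ≡⟨ cong (∑ H) (sym 𝓜u≡E) ⟩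
      ∑ H (𝓜 u) ∎

  _⊏_ : Word → Word → Set
  y ⊏ u = length (𝓜 y) < length (𝓜 u)

  ⊏-wellFounded : WellFounded _⊏_
  ⊏-wellFounded = On.wellFounded (λ u → length (𝓜 u)) <-wellFounded

  F≈∑H-𝓜 : ∀ u → Acc _⊏_ u → u ≢ [] → F u ≈ ∑ H (𝓜 u)
  F≈∑H-𝓜 [] _ []≢[] = contradiction refl []≢[]
  F≈∑H-𝓜 (a ∷ w) (acc rec) _ with lastLayerView a w
  ... | cs , c , isCF , |cf|≡K = Step.F-u isCF |cf|≡K (λ y y≢[] y⊏u → F≈∑H-𝓜 y (rec y⊏u) y≢[])

  F≈∑H : ∀ u → ∃ λ xs → IsEnumeration (InM u) xs × F u ≈ ∑ H xs
  F≈∑H []      = map cliqueWord cliques , cliqueWords-enumerate , F[]≈∑H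
  F≈∑H (a ∷ w) = 𝓜 (a ∷ w) , 𝓜-enumerates a w , F≈∑H-𝓜 (a ∷ w) (⊏-wellFounded _) (λ ())

theorem1 : {c ℓ : Level} (G : AbelianGroup c ℓ) (n : ℕ) → 2 ≤ n →
    (I : Rel (Fin n) 0ℓ) (I? : Decidable I) → Symmetric I → Irreflexive _≡_ I →
    (F H : Trace.Word I I? → AbelianGroup.Carrier G) →
    (∀ u v → Trace._~_ I I? u v → AbelianGroup._≈_ G (F u) (F v)) →
    Trace.IsGradedMobius I I? G F H →
    (u : Trace.Word I I?) →
    Σ (List (Trace.Word I I?)) (λ xs →
      Trace.IsEnumeration I I? (Trace.InM I I? u) xs
      × AbelianGroup._≈_ G (F u) (GroupOps.sumG G (map H xs)))
theorem1 G n _ I I? I-sym I-irrefl F H F-resp-~ mobius = Inversion.F≈∑H I I? I-sym I-irrefl G F H F-resp-~ mobius
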